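{- Let $q$ be a power of an odd prime, $a\in\mathbb{F}_q^*\setminus\{1,-1\}$, and $f:\mathbb{F}_{q^2}\to\mathbb{F}_{q^2}$, $f(X)=X^{q+1}+aX^2$. Let $\beta\in\mathbb{F}_{q^2}$ with $\beta^2=b$, $b$ a non-square in $\mathbb{F}_q$. For $\alpha\in\mathbb{F}_q^*$: (1) $\#f^{ -1}(\alpha)=0$ if $\chi_2(\alpha(a-1))=1$ and $\chi_2(\alpha(a+1))=-1$; $\#f^{ -1}(\alpha)=4$ if $\chi_2(\alpha(a-1))=-1$ and $\chi_2(\alpha(a+1))=1$; and $\#f^{ -1}(\alpha)=2$ otherwise. (2) If $q\equiv3\pmod4$, then $\#f^{ -1}(\alpha\beta)=0$ if $\chi_2(1-a^2)=1$ and $\#f^{ -1}(\alpha\beta)=2$ if $\chi_2(1-a^2)=-1$. (3) If $q\equiv1\pmod4$, then $\#f^{ -1}(\alpha\beta)=4$ if $\chi_2(1-a^2)=-1$ and $\chi_2(2\gamma_a\alpha a)=1$, and $\#f^{ -1}(\alpha\beta)=0$ otherwise, where (when $\chi_2(1-a^2)=-1$) $\gamma_a\in\mathbb{F}_q$ is an element with $\gamma_a^2=-\frac{(a-1)b}{a+1}$.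
   Context: $f^{ -1}(\alpha)=\{\gamma\in\mathbb{F}_{q^2}: f(\gamma)=\alpha\}$. $\chi_2$ is the quadratic character of $\mathbb{F}_q$: $\chi_2(x)=1$ for nonzero squares, $-1$ for non-squares, $\chi_2(0)=0$. (When $q\equiv1\pmod 4$ the value $\chi_2(2\gamma_a\alpha a)$ does not depend on the choice of sign of $\gamma_a$.) -}

module Defs where

open import Data.Nat as ℕ using (ℕ; zero; suc)
open import Data.Integer as ℤ using (ℤ)
open import Data.List using (List; length; filter)
open import Data.List.Membership.Propositional using (_∈_)
open import Data.List.Relation.Unary.Unique.Propositional using (Unique)
open import Data.List.Relation.Unary.Any using (any?)
open import Data.Product using (∃; _×_)
open import Data.Product.Properties using ()
open import Relation.Nullary using (¬_; yes; no)
open import Relation.Nullary.Decidable using (_×-dec_)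
open import Relation.Binary.PropositionalEquality using (_≡_)
open import Relation.Binary.Definitions using (DecidableEquality)
open import Algebra.Structures using (IsCommutativeRing)

record FiniteField : Set₁ where
  infixl 7 _*_
  infixl 6 _+_
  infix 4 _≟_
  field
    Carrier  : Set
    _+_ _*_  : Carrier → Carrier → Carrier
    -_       : Carrier → Carrier
    0# 1#    : Carrier
    isCommutativeRing : IsCommutativeRing _≡_ _+_ _*_ -_ 0# 1#
    0≢1      : ¬ (0# ≡ 1#)
    inverse  : ∀ x → ¬ (x ≡ 0#) → ∃ λ y → x * y ≡ 1#
    _≟_      : DecidableEquality Carrier
    elements : List Carrier
    complete : ∀ x → x ∈ elements
    unique   : Unique elements

  size : ℕ
  size = length elements

  infixl 6 _-_
  _-_ : Carrier → Carrier → Carrier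
  x - y = x + (- y)

  2# : Carrier
  2# = 1# + 1#

  infixr 8 _^_
  _^_ : Carrier → ℕ → Carrier
  x ^ zero  = 1#
  x ^ suc n = x * (x ^ n)

  preimageCount : (Carrier → Carrier) → Carrier → ℕ
  preimageCount f t = length (filter (λ γ → f γ ≟ t) elements)

  -- Given q with |L| = q², the subfield F_q = { x ∈ L : x^q = x }.
  InSub : ℕ → Carrier → Set
  InSub q x = x ^ q ≡ x

  χ₂ : ℕ → Carrier → ℤ
  χ₂ q x with x ≟ 0#
  ... | yes _ = ℤ.0ℤ
  ... | no _ with any? (λ y → (y ^ q ≟ y) ×-dec (y * y ≟ x)) elements
  ...   | yes _ = ℤ.1ℤ
  ...   | no _  = ℤ.-1ℤ

-- The q-power map frob x = x ^ q is an involutive automorphism of L (freshman's dream in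
-- characteristic p, and x ^ (q * q) ≡ x) whose fixed field is K = F_q; moreover X ^ (q + 1) = X * frob X.
--
-- If f X ≡ α, then X * X ∈ K, so frob X ≡ ± X.  For frob X ≡ X the equation is (a + 1) X² ≡ α, with two
-- solutions in K iff α (a + 1) is a square; for frob X ≡ - X it is (a - 1) X² ≡ α, and such X are β
-- times elements of K, so there are two iff α (a - 1) is a non-square.
--
-- If f X ≡ α β, write X = u + v β with u, v ∈ K; then f X = A + B β with A = (a + 1) u² + (a - 1) b v²
-- and B = 2 a u v.  A solution makes γ = u / v a root of γ² (a + 1) = -(a - 1) b, which is solvable in K
-- iff 1 - a² is a non-square.  Given γ, the solutions are u + α / (2 a u) β with u² = ± γ α / (2 a), and
-- whether -1 is a square (q ≡ 1 mod 4) decides if one or both of ± γ α / (2 a) are squares.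
--
-- That a product of two non-squares of K is a square is Euler's criterion, proved by pairing the units
-- of K with c / x and, for Wilson's theorem, with x ⁻¹.

module Submission where

open import Defs
open import Data.Nat as ℕ using (ℕ; zero; suc; _<_; _≥_; s≤s; z≤n; _!; _%_; _/_)
import Data.Nat.Properties as ℕ
open import Data.Nat.Divisibility using (_∣_; divides; m∣m*n; ∣1⇒≡1; ∣⇒≤)
open import Data.Nat.DivMod using (m/n*n≡m; m%n<n; m≡m%n+[m/n]*n)
open import Data.Nat.Primality using (Prime; euclidsLemma; prime⇒nonTrivial; prime⇒irreducible)
open import Data.Nat.Combinatorics using (_C_; k![n∸k]!∣n!; nCk≡n!/k![n-k]!; nCn≡1)
open import Data.Integer as ℤ using (ℤ; 1ℤ; -1ℤ)
import Data.Integer.Properties as ℤ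
open import Data.Sign as Sign using (Sign)
open import Data.Fin as Fin using (Fin; fromℕ; inject₁; toℕ)
import Data.Fin.Properties as Fin
open import Data.Maybe using (Maybe; just; nothing)
open import Data.Empty using (⊥-elim)
open import Data.Sum as Sum using (_⊎_; inj₁; inj₂; reduce; [_,_]′)
open import Data.Product using (∃; ∃₂; _×_; _,_; proj₁; proj₂)
open import Data.List using (List; []; _∷_; _++_; filter; length; map; foldr)
open import Data.List.Membership.Propositional using (_∈_; find; lose)
open import Data.List.Membership.Propositional.Properties
  using (∈-filter⁺; ∈-filter⁻; ∈-map⁺; ∈-map⁻; ++-∈⇔; ∈-++⁺ˡ; ∈-++⁺ʳ)
open import Data.List.Membership.Propositional.Properties.WithK using (unique∧set⇒bag)
open import Data.List.Relation.Unary.Any using (here; there; any?)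
open import Data.List.Relation.Unary.All as All using (All; []; _∷_)
open import Data.List.Relation.Unary.AllPairs using ([]; _∷_)
open import Data.List.Relation.Unary.Unique.Propositional using (Unique)
import Data.List.Relation.Unary.Unique.Propositional.Properties as Unique
open import Data.List.Relation.Binary.BagAndSetEquality using (∼bag⇒↭)
open import Data.List.Relation.Binary.Permutation.Propositional using (_↭_; ↭-trans; ↭-prep; ↭⇒↭ₛ)
open import Data.List.Relation.Binary.Permutation.Propositional.Properties using (↭-length)
import Data.List.Relation.Binary.Permutation.Setoid.Properties as PermutationSetoid
open import Function using (_∘_; id)
open import Function.Bundles using (_⇔_; mk⇔; Equivalence)
open import Level using (0ℓ)
open import Relation.Unary using (Pred)
open import Relation.Nullary using (Dec; yes; no; ¬_; ¬?)
open import Relation.Nullary.Decidable using (_×-dec_; toSum; decidable-stable)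
open import Relation.Binary.PropositionalEquality
open import Algebra.Bundles using (CommutativeRing)
import Algebra.Properties.Ring as RingProperties
import Algebra.Properties.CommutativeSemigroup as CommutativeSemigroupProperties
import Algebra.Properties.Monoid.Mult.TCOptimised as MonoidMult
import Algebra.Properties.Semiring.Mult.TCOptimised as SemiringMult
import Algebra.Properties.Semiring.Mult as Mult
import Algebra.Properties.CommutativeSemiring.Binomial as Binomial
import Algebra.Properties.Monoid.Sum as MonoidSum
import Algebra.Properties.Semiring.Exp as Exp
import Algebra.Solver.Ring.AlmostCommutativeRing as ACR

module _ {A : Set} where

  ↭-of-same-elements : ∀ {xs ys : List A} → Unique xs → Unique ys →
                       (∀ {z} → z ∈ xs ⇔ z ∈ ys) → xs ↭ ys
  ↭-of-same-elements xs! ys! same = ∼bag⇒↭ (unique∧set⇒bag xs! ys! same)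

  length-filter-complete : ∀ {P : Pred A 0ℓ} (P? : ∀ x → Dec (P x)) {xs ys : List A} →
                           (∀ x → x ∈ xs) → Unique xs → Unique ys →
                           (∀ {z} → P z ⇔ z ∈ ys) → length (filter P? xs) ≡ length ys
  length-filter-complete P? {xs} complete xs! ys! P⇔∈ =
    ↭-length (↭-of-same-elements (Unique.filter⁺ P? xs!) ys! (mk⇔
      (λ z∈ → Equivalence.to P⇔∈ (proj₂ (∈-filter⁻ P? {xs = xs} z∈)))
      (λ z∈ → ∈-filter⁺ P? (complete _) (Equivalence.from P⇔∈ z∈))))

module _ {A B : Set} (f : A → B) where

  map⁺-injectiveOn : ∀ {xs} → (∀ {x y} → x ∈ xs → y ∈ xs → f x ≡ f y → x ≡ y) →
                     Unique xs → Unique (map f xs)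
  map⁺-injectiveOn {[]} inj [] = []
  map⁺-injectiveOn {x ∷ xs} inj (x∉ ∷ xs!) =
    apart x∉ there ∷ map⁺-injectiveOn (λ x∈ y∈ → inj (there x∈) (there y∈)) xs!
    where
    apart : ∀ {ys} → All (λ y → ¬ x ≡ y) ys → (∀ {y} → y ∈ ys → y ∈ x ∷ xs) →
            All (λ w → ¬ f x ≡ w) (map f ys)
    apart [] _ = []
    apart (x≢y ∷ x≢ys) ⊆ = (λ fx≡fy → x≢y (inj (here refl) (⊆ (here refl)) fx≡fy))
                          ∷ apart x≢ys (λ y∈ → ⊆ (there y∈))

module _ {A : Set} (f : A → A) where

  map-↭-self : ∀ {xs} → (∀ {x y} → f x ≡ f y → x ≡ y) → Unique xs →
               (∀ {x} → x ∈ xs → f x ∈ xs) → (∀ {z} → z ∈ xs → ∃ λ y → y ∈ xs × f y ≡ z) →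
               map f xs ↭ xs
  map-↭-self inj xs! into onto = ↭-of-same-elements (Unique.map⁺ inj xs!) xs! (mk⇔
    (λ z∈ → let (y , y∈ , z≡fy) = ∈-map⁻ f z∈ in subst (_∈ _) (sym z≡fy) (into y∈))
    (λ z∈ → let (y , y∈ , fy≡z) = onto z∈ in subst (_∈ map f _) fy≡z (∈-map⁺ f y∈)))


n∣n! : ∀ {n} → 0 < n → n ∣ n !
n∣n! {suc n} _ = m∣m*n (n !)

module _ {p} (p-prime : Prime p) where

  private
    1<p : 1 < p
    1<p = ℕ.nonTrivial⇒n>1 p {{prime⇒nonTrivial p-prime}}

  p∤m! : ∀ m → m < p → ¬ p ∣ m !
  p∤m! zero _ p∣1 = ℕ.<⇒≢ 1<p (sym (∣1⇒≡1 p∣1))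
  p∤m! (suc m) m<p p∣m! with euclidsLemma (suc m) (m !) p-prime p∣m!
  ... | inj₁ p∣1+m = ℕ.<⇒≱ m<p (∣⇒≤ p∣1+m)
  ... | inj₂ p∣m!′ = p∤m! m (ℕ.<-trans (ℕ.n<1+n m) m<p) p∣m!′

  -- p divides p! = pCk · k! · (p ∸ k)! but neither factorial.
  p∣pCk : ∀ {k} → 0 < k → k < p → p ∣ p C k
  p∣pCk {k} 0<k k<p with euclidsLemma (p C k) (k ! ℕ.* (p ℕ.∸ k) !) p-prime p∣product
    where
    instance _ = ℕ._!*_!≢0 k (p ℕ.∸ k)
    k≤p = ℕ.<⇒≤ k<p
    p∣product : p ∣ (p C k) ℕ.* (k ! ℕ.* (p ℕ.∸ k) !)
    p∣product = subst (p ∣_)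
      (sym (trans (cong (ℕ._* (k ! ℕ.* (p ℕ.∸ k) !)) (nCk≡n!/k![n-k]! k≤p)) (m/n*n≡m (k![n∸k]!∣n! k≤p))))
      (n∣n! (ℕ.<-trans (s≤s z≤n) 1<p))
  ... | inj₁ p∣pCk = p∣pCk
  ... | inj₂ p∣k![p∸k]! with euclidsLemma (k !) ((p ℕ.∸ k) !) p-prime p∣k![p∸k]!
  ...   | inj₁ p∣k! = ⊥-elim (p∤m! k k<p p∣k!)
  ...   | inj₂ p∣[p∸k]! = ⊥-elim (p∤m! (p ℕ.∸ k) (ℕ.∸-monoʳ-< {p} {k} {0} 0<k (ℕ.<⇒≤ k<p)) p∣[p∸k]!)


module FiniteFieldProperties (L : FiniteField) where

  open FiniteField L

  commutativeRing : CommutativeRing _ _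
  commutativeRing = record { isCommutativeRing = isCommutativeRing }

  open CommutativeRing commutativeRing public
    using ( +-assoc; +-comm; +-identityˡ; +-identityʳ; -‿inverseʳ
          ; *-assoc; *-comm; *-identityˡ; *-identityʳ; zeroˡ; zeroʳ
          ; +-isCommutativeMonoid; *-isCommutativeMonoid)
  open RingProperties (CommutativeRing.ring commutativeRing) public
    using (-‿involutive; -‿+-comm; -0#≈0#; -‿distribʳ-*; -1*x≈-x)
  open SemiringMult (CommutativeRing.semiring commutativeRing) public
    using (×1-homo-*) renaming (_×_ to _·_)
  open MonoidMult (CommutativeRing.+-monoid commutativeRing) public
    using (×-homo-+; 1+×)
  open CommutativeSemigroupProperties (CommutativeRing.*-commutativeSemigroup commutativeRing) public
    using (interchange)

  -- The ring solver with integer coefficients; an integer n is read as n · 1#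
  -- with the optimised _×_, so that 1 and 2 denote 1# and 2# definitionally.
  module IntegerCoefficients where

    ⟦_⟧ : ℤ → Carrier
    ⟦ ℤ.+ n ⟧    = n · 1#
    ⟦ ℤ.-[1+ n ] ⟧ = - (suc n · 1#)

    ⊖-homo : ∀ m n → ⟦ m ℤ.⊖ n ⟧ ≡ m · 1# - n · 1#
    ⊖-homo m zero = sym (trans (cong (m · 1# +_) -0#≈0#) (+-identityʳ _))
    ⊖-homo zero (suc n) = sym (+-identityˡ _)
    ⊖-homo (suc m) (suc n) = begin
      ⟦ suc m ℤ.⊖ suc n ⟧                  ≡⟨ cong ⟦_⟧ (ℤ.[1+m]⊖[1+n]≡m⊖n m n) ⟩
      ⟦ m ℤ.⊖ n ⟧                          ≡⟨ ⊖-homo m n ⟩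
      m · 1# - n · 1#                      ≡⟨ shift (m · 1#) (n · 1#) ⟩
      (1# + m · 1#) - (1# + n · 1#)        ≡⟨ sym (cong₂ _-_ (1+× m 1#) (1+× n 1#)) ⟩
      suc m · 1# - suc n · 1#              ∎
      where
      open ≡-Reasoning
      shift : ∀ x y → x - y ≡ (1# + x) - (1# + y)
      shift x y = begin
        x - y                      ≡⟨ sym (+-identityˡ _) ⟩
        0# + (x - y)               ≡⟨ cong (_+ (x - y)) (sym (-‿inverseʳ 1#)) ⟩
        (1# - 1#) + (x - y)        ≡⟨ +-assoc 1# (- 1#) (x - y) ⟩
        1# + (- 1# + (x - y))      ≡⟨ cong (1# +_) (sym (+-assoc (- 1#) x (- y))) ⟩
        1# + ((- 1# + x) - y)      ≡⟨ cong (λ z → 1# + (z - y)) (+-comm (- 1#) x) ⟩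
        1# + ((x - 1#) - y)        ≡⟨ cong (1# +_) (+-assoc x (- 1#) (- y)) ⟩
        1# + (x + (- 1# - y))      ≡⟨ cong (λ z → 1# + (x + z)) (-‿+-comm 1# y) ⟩
        1# + (x - (1# + y))        ≡⟨ sym (+-assoc 1# x _) ⟩
        (1# + x) - (1# + y)        ∎

    +-homo : ∀ i j → ⟦ i ℤ.+ j ⟧ ≡ ⟦ i ⟧ + ⟦ j ⟧
    +-homo (ℤ.+ m) (ℤ.+ n) = ×-homo-+ 1# m n
    +-homo (ℤ.+ m) ℤ.-[1+ n ] = ⊖-homo m (suc n)
    +-homo ℤ.-[1+ m ] (ℤ.+ n) = trans (⊖-homo n (suc m)) (+-comm _ _)
    +-homo ℤ.-[1+ m ] ℤ.-[1+ n ] = begin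
      - (suc (suc (m ℕ.+ n)) · 1#)          ≡⟨ cong (λ k → - (suc k · 1#)) (sym (ℕ.+-suc m n)) ⟩
      - ((suc m ℕ.+ suc n) · 1#)            ≡⟨ cong -_ (×-homo-+ 1# (suc m) (suc n)) ⟩
      - (suc m · 1# + suc n · 1#)           ≡⟨ sym (-‿+-comm _ _) ⟩
      - (suc m · 1#) + - (suc n · 1#)       ∎
      where open ≡-Reasoning

    sign : Sign → Carrier
    sign Sign.+ = 1#
    sign Sign.- = - 1#

    sign-homo : ∀ s t → sign (s Sign.* t) ≡ sign s * sign t
    sign-homo Sign.+ t = sym (*-identityˡ _)
    sign-homo Sign.- Sign.+ = sym (*-identityʳ _)
    sign-homo Sign.- Sign.- = sym (trans (-1*x≈-x _) (-‿involutive _))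

    ⟦⟧-sign-abs : ∀ i → ⟦ i ⟧ ≡ sign (ℤ.sign i) * (ℤ.∣ i ∣ · 1#)
    ⟦⟧-sign-abs (ℤ.+ n) = sym (*-identityˡ _)
    ⟦⟧-sign-abs ℤ.-[1+ n ] = sym (-1*x≈-x _)

    ⟦◃⟧ : ∀ s n → ⟦ s ℤ.◃ n ⟧ ≡ sign s * (n · 1#)
    ⟦◃⟧ s zero = sym (zeroʳ _)
    ⟦◃⟧ Sign.+ (suc n) = sym (*-identityˡ _)
    ⟦◃⟧ Sign.- (suc n) = sym (-1*x≈-x _)

    *-homo : ∀ i j → ⟦ i ℤ.* j ⟧ ≡ ⟦ i ⟧ * ⟦ j ⟧
    *-homo i j = begin
      ⟦ (ℤ.sign i Sign.* ℤ.sign j) ℤ.◃ (ℤ.∣ i ∣ ℕ.* ℤ.∣ j ∣) ⟧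
        ≡⟨ ⟦◃⟧ _ (ℤ.∣ i ∣ ℕ.* ℤ.∣ j ∣) ⟩
      sign (ℤ.sign i Sign.* ℤ.sign j) * ((ℤ.∣ i ∣ ℕ.* ℤ.∣ j ∣) · 1#)
        ≡⟨ cong₂ _*_ (sign-homo (ℤ.sign i) (ℤ.sign j)) (×1-homo-* ℤ.∣ i ∣ ℤ.∣ j ∣) ⟩
      (sign (ℤ.sign i) * sign (ℤ.sign j)) * ((ℤ.∣ i ∣ · 1#) * (ℤ.∣ j ∣ · 1#))
        ≡⟨ interchange _ _ _ _ ⟩
      (sign (ℤ.sign i) * (ℤ.∣ i ∣ · 1#)) * (sign (ℤ.sign j) * (ℤ.∣ j ∣ · 1#))
        ≡⟨ sym (cong₂ _*_ (⟦⟧-sign-abs i) (⟦⟧-sign-abs j)) ⟩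
      ⟦ i ⟧ * ⟦ j ⟧ ∎
      where open ≡-Reasoning

    -‿homo : ∀ i → ⟦ ℤ.- i ⟧ ≡ - ⟦ i ⟧
    -‿homo ℤ.-[1+ n ] = sym (-‿involutive _)
    -‿homo (ℤ.+ zero) = sym -0#≈0#
    -‿homo (ℤ.+ suc n) = refl

    homomorphism : CommutativeRing.rawRing ℤ.+-*-commutativeRing
                     ACR.-Raw-AlmostCommutative⟶ ACR.fromCommutativeRing commutativeRing
    homomorphism = record
      { ⟦_⟧ = ⟦_⟧ ; +-homo = +-homo ; *-homo = *-homo ; -‿homo = -‿homo
      ; 0-homo = refl ; 1-homo = refl }

    ⟦⟧-≟ : ∀ i j → Maybe (⟦ i ⟧ ≡ ⟦ j ⟧)
    ⟦⟧-≟ i j with i ℤ.≟ j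
    ... | yes i≡j = just (cong ⟦_⟧ i≡j)
    ... | no _    = nothing

  open import Algebra.Solver.Ring _ _ IntegerCoefficients.homomorphism IntegerCoefficients.⟦⟧-≟ public

  infix 9 _⁻¹
  _⁻¹ : Carrier → Carrier
  x ⁻¹ with x ≟ 0#
  ... | yes _  = 0#
  ... | no x≢0 = proj₁ (inverse x x≢0)

  0⁻¹≡0 : 0# ⁻¹ ≡ 0#
  0⁻¹≡0 with 0# ≟ 0#
  ... | yes _ = refl
  ... | no 0≢0 = ⊥-elim (0≢0 refl)

  x*x⁻¹≡1 : ∀ {x} → ¬ x ≡ 0# → x * x ⁻¹ ≡ 1#
  x*x⁻¹≡1 {x} x≢0 with x ≟ 0#
  ... | yes x≡0 = ⊥-elim (x≢0 x≡0)
  ... | no x≢0′ = proj₂ (inverse x x≢0′)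

  x⁻¹*x≡1 : ∀ {x} → ¬ x ≡ 0# → x ⁻¹ * x ≡ 1#
  x⁻¹*x≡1 x≢0 = trans (*-comm _ _) (x*x⁻¹≡1 x≢0)

  1≢0 : ¬ 1# ≡ 0#
  1≢0 1≡0 = 0≢1 (sym 1≡0)

  *-cancelˡ : ∀ {c x y} → ¬ c ≡ 0# → c * x ≡ c * y → x ≡ y
  *-cancelˡ {c} {x} {y} c≢0 cx≡cy = begin
    x                 ≡⟨ sym (*-identityˡ x) ⟩
    1# * x            ≡⟨ cong (_* x) (sym (x⁻¹*x≡1 c≢0)) ⟩
    (c ⁻¹ * c) * x    ≡⟨ *-assoc _ _ _ ⟩
    c ⁻¹ * (c * x)    ≡⟨ cong (c ⁻¹ *_) cx≡cy ⟩
    c ⁻¹ * (c * y)    ≡⟨ sym (*-assoc _ _ _) ⟩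
    (c ⁻¹ * c) * y    ≡⟨ cong (_* y) (x⁻¹*x≡1 c≢0) ⟩
    1# * y            ≡⟨ *-identityˡ y ⟩
    y                 ∎
    where open ≡-Reasoning

  *-≢0 : ∀ {x y} → ¬ x ≡ 0# → ¬ y ≡ 0# → ¬ x * y ≡ 0#
  *-≢0 {x} {y} x≢0 y≢0 xy≡0 = y≢0 (*-cancelˡ x≢0 (trans xy≡0 (sym (zeroʳ x))))

  x*y≡0⇒x≡0∨y≡0 : ∀ {x y} → x * y ≡ 0# → x ≡ 0# ⊎ y ≡ 0#
  x*y≡0⇒x≡0∨y≡0 {x} {y} xy≡0 with x ≟ 0# | y ≟ 0#
  ... | yes x≡0 | _       = inj₁ x≡0
  ... | no _    | yes y≡0 = inj₂ y≡0
  ... | no x≢0  | no y≢0  = ⊥-elim (*-≢0 x≢0 y≢0 xy≡0)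

  ⁻¹-≢0 : ∀ {x} → ¬ x ≡ 0# → ¬ x ⁻¹ ≡ 0#
  ⁻¹-≢0 {x} x≢0 x⁻¹≡0 = 1≢0 (trans (sym (x*x⁻¹≡1 x≢0)) (trans (cong (x *_) x⁻¹≡0) (zeroʳ x)))

  ⁻¹-unique : ∀ {x y} → x * y ≡ 1# → y ≡ x ⁻¹
  ⁻¹-unique {x} {y} xy≡1 = *-cancelˡ x≢0 (trans xy≡1 (sym (x*x⁻¹≡1 x≢0)))
    where
    x≢0 : ¬ x ≡ 0#
    x≢0 x≡0 = 1≢0 (trans (sym xy≡1) (trans (cong (_* y) x≡0) (zeroˡ y)))

  ⁻¹-involutive : ∀ {x} → ¬ x ≡ 0# → x ⁻¹ ⁻¹ ≡ x
  ⁻¹-involutive x≢0 = sym (⁻¹-unique (x⁻¹*x≡1 x≢0))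

  ⁻¹-injective : ∀ {x y} → ¬ x ≡ 0# → ¬ y ≡ 0# → x ⁻¹ ≡ y ⁻¹ → x ≡ y
  ⁻¹-injective {x} {y} x≢0 y≢0 x⁻¹≡y⁻¹ =
    trans (sym (⁻¹-involutive x≢0)) (trans (cong _⁻¹ x⁻¹≡y⁻¹) (⁻¹-involutive y≢0))

  ⁻¹-distrib-* : ∀ {x y} → ¬ x ≡ 0# → ¬ y ≡ 0# → (x * y) ⁻¹ ≡ x ⁻¹ * y ⁻¹
  ⁻¹-distrib-* {x} {y} x≢0 y≢0 = sym (⁻¹-unique (begin
    (x * y) * (x ⁻¹ * y ⁻¹)   ≡⟨ interchange x y (x ⁻¹) (y ⁻¹) ⟩
    (x * x ⁻¹) * (y * y ⁻¹)   ≡⟨ cong₂ _*_ (x*x⁻¹≡1 x≢0) (x*x⁻¹≡1 y≢0) ⟩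
    1# * 1#                   ≡⟨ *-identityˡ 1# ⟩
    1#                        ∎))
    where open ≡-Reasoning

  x-y≡0⇒x≡y : ∀ {x y} → x - y ≡ 0# → x ≡ y
  x-y≡0⇒x≡y {x} {y} x-y≡0 = begin
    x              ≡⟨ solve 2 (λ x y → x := (x :- y) :+ y) refl x y ⟩
    (x - y) + y    ≡⟨ cong (_+ y) x-y≡0 ⟩
    0# + y         ≡⟨ +-identityˡ y ⟩
    y              ∎
    where open ≡-Reasoning

  -‿unique : ∀ {x y} → x + y ≡ 0# → y ≡ - x
  -‿unique {x} {y} x+y≡0 = x-y≡0⇒x≡y (begin
    y - - x        ≡⟨ solve 2 (λ x y → y :- :- x := x :+ y) refl x y ⟩
    x + y          ≡⟨ x+y≡0 ⟩
    0#             ∎)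
    where open ≡-Reasoning

  -‿≢0 : ∀ {x} → ¬ x ≡ 0# → ¬ - x ≡ 0#
  -‿≢0 {x} x≢0 -x≡0 = x≢0 (trans (sym (-‿involutive x)) (trans (cong -_ -x≡0) -0#≈0#))

  x*x≡y*y⇒x≡±y : ∀ {x y} → x * x ≡ y * y → x ≡ y ⊎ x ≡ - y
  x*x≡y*y⇒x≡±y {x} {y} xx≡yy with x*y≡0⇒x≡0∨y≡0 {x - y} {x + y} (begin
      (x - y) * (x + y)   ≡⟨ solve 2 (λ x y → (x :- y) :* (x :+ y) := x :* x :- y :* y) refl x y ⟩
      x * x - y * y       ≡⟨ cong (_- y * y) xx≡yy ⟩
      y * y - y * y       ≡⟨ -‿inverseʳ _ ⟩
      0#                  ∎)
    where open ≡-Reasoning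
  ... | inj₁ x-y≡0 = inj₁ (x-y≡0⇒x≡y x-y≡0)
  ... | inj₂ x+y≡0 = inj₂ (trans (sym (-‿involutive x)) (cong -_ (sym (-‿unique x+y≡0))))

  x*x≡c⇒x≢0 : ∀ {x c} → ¬ c ≡ 0# → x * x ≡ c → ¬ x ≡ 0#
  x*x≡c⇒x≢0 {x} c≢0 xx≡c x≡0 = c≢0 (trans (sym xx≡c) (trans (cong (_* x) x≡0) (zeroˡ x)))

  ^-distribˡ-+-* : ∀ x m n → x ^ (m ℕ.+ n) ≡ x ^ m * x ^ n
  ^-distribˡ-+-* x zero n = sym (*-identityˡ _)
  ^-distribˡ-+-* x (suc m) n = trans (cong (x *_) (^-distribˡ-+-* x m n)) (sym (*-assoc _ _ _))

  ^-*-assoc : ∀ x m n → (x ^ m) ^ n ≡ x ^ (m ℕ.* n)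
  ^-*-assoc x m zero = cong (x ^_) (sym (ℕ.*-zeroʳ m))
  ^-*-assoc x m (suc n) = begin
    x ^ m * (x ^ m) ^ n      ≡⟨ cong (x ^ m *_) (^-*-assoc x m n) ⟩
    x ^ m * x ^ (m ℕ.* n)    ≡⟨ sym (^-distribˡ-+-* x m (m ℕ.* n)) ⟩
    x ^ (m ℕ.+ m ℕ.* n)      ≡⟨ cong (x ^_) (sym (ℕ.*-suc m n)) ⟩
    x ^ (m ℕ.* suc n)        ∎
    where open ≡-Reasoning

  ^-distribʳ-* : ∀ x y n → (x * y) ^ n ≡ x ^ n * y ^ n
  ^-distribʳ-* x y zero = sym (*-identityˡ _)
  ^-distribʳ-* x y (suc n) = trans (cong ((x * y) *_) (^-distribʳ-* x y n)) (interchange _ _ _ _)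

  1^n≡1 : ∀ n → 1# ^ n ≡ 1#
  1^n≡1 zero = refl
  1^n≡1 (suc n) = trans (*-identityˡ _) (1^n≡1 n)

  ^-≢0 : ∀ {x} n → ¬ x ≡ 0# → ¬ x ^ n ≡ 0#
  ^-≢0 zero x≢0 = 1≢0
  ^-≢0 (suc n) x≢0 = *-≢0 x≢0 (^-≢0 n x≢0)

  ·1-homo-^ : ∀ m n → (m ℕ.^ n) · 1# ≡ (m · 1#) ^ n
  ·1-homo-^ m zero = refl
  ·1-homo-^ m (suc n) = trans (×1-homo-* m (m ℕ.^ n)) (cong ((m · 1#) *_) (·1-homo-^ m n))

  x^n≡0⇒x≡0 : ∀ {x} n → x ^ n ≡ 0# → x ≡ 0#
  x^n≡0⇒x≡0 {x} n xⁿ≡0 with x ≟ 0#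
  ... | yes x≡0 = x≡0
  ... | no x≢0  = ⊥-elim (^-≢0 n x≢0 xⁿ≡0)

  y≡z*x⁻¹⇒x*y≡z : ∀ {x y z} → ¬ x ≡ 0# → y ≡ z * x ⁻¹ → x * y ≡ z
  y≡z*x⁻¹⇒x*y≡z {x} {y} {z} x≢0 refl = begin
    x * (z * x ⁻¹)     ≡⟨ solve 3 (λ x z w → x :* (z :* w) := z :* (x :* w)) refl x z (x ⁻¹) ⟩
    z * (x * x ⁻¹)     ≡⟨ cong (z *_) (x*x⁻¹≡1 x≢0) ⟩
    z * 1#             ≡⟨ *-identityʳ z ⟩
    z                  ∎
    where open ≡-Reasoning

  x*y≡z⇒y≡z*x⁻¹ : ∀ {x y z} → ¬ x ≡ 0# → x * y ≡ z → y ≡ z * x ⁻¹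
  x*y≡z⇒y≡z*x⁻¹ x≢0 xy≡z = *-cancelˡ x≢0 (trans xy≡z (sym (y≡z*x⁻¹⇒x*y≡z x≢0 refl)))

  ∏ ∑ : List Carrier → Carrier
  ∏ = foldr _*_ 1#
  ∑ = foldr _+_ 0#

  ∏-↭ : ∀ {xs ys} → xs ↭ ys → ∏ xs ≡ ∏ ys
  ∏-↭ xs↭ys = PermutationSetoid.foldr-commMonoid (setoid Carrier) *-isCommutativeMonoid (↭⇒↭ₛ xs↭ys)

  ∑-↭ : ∀ {xs ys} → xs ↭ ys → ∑ xs ≡ ∑ ys
  ∑-↭ xs↭ys = PermutationSetoid.foldr-commMonoid (setoid Carrier) +-isCommutativeMonoid (↭⇒↭ₛ xs↭ys)

  ∏-map-* : ∀ c xs → ∏ (map (c *_) xs) ≡ c ^ length xs * ∏ xs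
  ∏-map-* c [] = sym (*-identityˡ _)
  ∏-map-* c (x ∷ xs) = trans (cong ((c * x) *_) (∏-map-* c xs)) (interchange _ _ _ _)

  ∑-map-+ : ∀ c xs → ∑ (map (c +_) xs) ≡ length xs · c + ∑ xs
  ∑-map-+ c [] = sym (+-identityˡ _)
  ∑-map-+ c (x ∷ xs) = begin
    (c + x) + ∑ (map (c +_) xs)          ≡⟨ cong ((c + x) +_) (∑-map-+ c xs) ⟩
    (c + x) + (length xs · c + ∑ xs)     ≡⟨ solve 4 (λ c x n s → (c :+ x) :+ (n :+ s) := (c :+ n) :+ (x :+ s))
                                                   refl c x (length xs · c) (∑ xs) ⟩
    (c + length xs · c) + (x + ∑ xs)     ≡⟨ cong (_+ (x + ∑ xs)) (sym (1+× (length xs) c)) ⟩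
    suc (length xs) · c + (x + ∑ xs)     ∎
    where open ≡-Reasoning

  ∏-≢0 : ∀ {xs} → All (λ x → ¬ x ≡ 0#) xs → ¬ ∏ xs ≡ 0#
  ∏-≢0 [] = 1≢0
  ∏-≢0 (x≢0 ∷ xs≢0) = *-≢0 x≢0 (∏-≢0 xs≢0)

  units : List Carrier
  units = filter (λ x → ¬? (x ≟ 0#)) elements

  units! : Unique units
  units! = Unique.filter⁺ _ unique

  ∈-units : ∀ {x} → ¬ x ≡ 0# → x ∈ units
  ∈-units x≢0 = ∈-filter⁺ _ (complete _) x≢0

  ∈-units⁻ : ∀ {x} → x ∈ units → ¬ x ≡ 0#
  ∈-units⁻ x∈ = proj₂ (∈-filter⁻ _ {xs = elements} x∈)

  size≡1+#units : size ≡ suc (length units)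
  size≡1+#units = ↭-length (↭-of-same-elements unique (0∉units ∷ units!) (λ {z} → mk⇔
    (λ _ → [ here , there ∘ ∈-units ]′ (toSum (z ≟ 0#)))
    (λ _ → complete z)))
    where
    0∉units : All (λ y → ¬ 0# ≡ y) units
    0∉units = All.tabulate (λ y∈ 0≡y → ∈-units⁻ y∈ (sym 0≡y))

  -- Multiplication by c ≢ 0 permutes the units, so c ^ #units * ∏ units ≡ ∏ units.
  x^#units≡1 : ∀ {c} → ¬ c ≡ 0# → c ^ length units ≡ 1#
  x^#units≡1 {c} c≢0 = *-cancelˡ (∏-≢0 (All.tabulate ∈-units⁻)) (begin
    ∏ units * c ^ length units   ≡⟨ *-comm _ _ ⟩
    c ^ length units * ∏ units   ≡⟨ sym (∏-map-* c units) ⟩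
    ∏ (map (c *_) units)         ≡⟨ ∏-↭ (map-↭-self (c *_) (*-cancelˡ c≢0) units!
                                       (λ x∈ → ∈-units (*-≢0 c≢0 (∈-units⁻ x∈)))
                                       (λ {z} z∈ → c ⁻¹ * z , ∈-units (*-≢0 (⁻¹-≢0 c≢0) (∈-units⁻ z∈)) , c*c⁻¹z≡z z)) ⟩
    ∏ units                      ≡⟨ sym (*-identityʳ _) ⟩
    ∏ units * 1#                 ∎)
    where
    open ≡-Reasoning
    c*c⁻¹z≡z : ∀ z → c * (c ⁻¹ * z) ≡ z
    c*c⁻¹z≡z z = trans (sym (*-assoc _ _ _)) (trans (cong (_* z) (x*x⁻¹≡1 c≢0)) (*-identityˡ z))

  x^size≡x : ∀ x → x ^ size ≡ x
  x^size≡x x rewrite size≡1+#units with x ≟ 0#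
  ... | yes x≡0 = trans (cong (_* x ^ length units) x≡0) (trans (zeroˡ _) (sym x≡0))
  ... | no x≢0  = trans (cong (x *_) (x^#units≡1 x≢0)) (*-identityʳ x)

  -- Translation by c permutes the field, so size · c + ∑ elements ≡ ∑ elements.
  size·x≡0 : ∀ c → size · c ≡ 0#
  size·x≡0 c = begin
    size · c                              ≡⟨ solve 2 (λ n s → n := (n :+ s) :- s) refl (size · c) (∑ elements) ⟩
    (size · c + ∑ elements) - ∑ elements  ≡⟨ cong (_- ∑ elements) (sym (∑-map-+ c elements)) ⟩
    ∑ (map (c +_) elements) - ∑ elements  ≡⟨ cong (_- ∑ elements) (∑-↭ translation-↭) ⟩
    ∑ elements - ∑ elements               ≡⟨ -‿inverseʳ _ ⟩
    0#                                    ∎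
    where
    open ≡-Reasoning
    translation-↭ : map (c +_) elements ↭ elements
    translation-↭ = map-↭-self (c +_) (λ {x} {y} c+x≡c+y → begin
        x                ≡⟨ solve 2 (λ c x → x := :- c :+ (c :+ x)) refl c x ⟩
        - c + (c + x)    ≡⟨ cong (- c +_) c+x≡c+y ⟩
        - c + (c + y)    ≡⟨ solve 2 (λ c y → :- c :+ (c :+ y) := y) refl c y ⟩
        y                ∎)
      unique (λ _ → complete _) (λ {z} _ → - c + z , complete _ , solve 2 (λ c z → c :+ (:- c :+ z) := z) refl c z)

  remove : Carrier → List Carrier → List Carrier
  remove y = filter (λ z → ¬? (z ≟ y))

  module _ {y : Carrier} where

    remove! : ∀ {xs} → Unique xs → Unique (remove y xs)
    remove! = Unique.filter⁺ _

    ∈-remove⁻ : ∀ {xs z} → z ∈ remove y xs → z ∈ xs × ¬ z ≡ y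
    ∈-remove⁻ {xs} = ∈-filter⁻ _ {xs = xs}

    ∈-remove : ∀ {xs z} → z ∈ xs → ¬ z ≡ y → z ∈ remove y xs
    ∈-remove = ∈-filter⁺ _

    ↭-remove : ∀ {xs} → Unique xs → y ∈ xs → xs ↭ y ∷ remove y xs
    ↭-remove {xs} xs! y∈ = ↭-of-same-elements xs! (y∉ ∷ remove! xs!) (λ {z} → mk⇔
      (λ z∈ → [ here , there ∘ ∈-remove z∈ ]′ (toSum (z ≟ y)))
      (λ { (here refl) → y∈ ; (there z∈) → proj₁ (∈-remove⁻ {xs} z∈) }))
      where
      y∉ : All (λ z → ¬ y ≡ z) (remove y xs)
      y∉ = All.tabulate (λ z∈ y≡z → proj₂ (∈-remove⁻ {xs} z∈) (sym y≡z))

  module Pairing (σ : Carrier → Carrier) (c : Carrier) where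

    Paired : List Carrier → Set
    Paired xs = (∀ {x} → x ∈ xs → σ x ∈ xs) × (∀ {x} → x ∈ xs → σ (σ x) ≡ x)
              × (∀ {x} → x ∈ xs → ¬ σ x ≡ x) × (∀ {x} → x ∈ xs → x * σ x ≡ c)

    pairing : ∀ {xs} → Unique xs → Paired xs → ∃ λ h → length xs ≡ h ℕ.+ h × ∏ xs ≡ c ^ h
    pairing {xs} = bounded (length xs) ℕ.≤-refl
      where
      -- Removing the pair x, σ x is not a structural descent, hence the length bound.
      bounded : ∀ {xs} fuel → length xs ℕ.≤ fuel → Unique xs → Paired xs →
                ∃ λ h → length xs ≡ h ℕ.+ h × ∏ xs ≡ c ^ h
      bounded {[]} _ _ _ _ = 0 , refl , refl
      bounded {x ∷ xs} (suc fuel) (ℕ.s≤s len≤) (x∉ ∷ xs!) (closed , invol , free , product) =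
        suc h , length-eq , product-eq
        where
        σx∈xs : σ x ∈ xs
        σx∈xs with closed (here refl)
        ... | here σx≡x = ⊥-elim (free (here refl) σx≡x)
        ... | there σx∈ = σx∈
        rest = remove (σ x) xs
        xs↭ : xs ↭ σ x ∷ rest
        xs↭ = ↭-remove xs! σx∈xs
        ⊆xs : ∀ {z} → z ∈ rest → z ∈ x ∷ xs
        ⊆xs z∈ = there (proj₁ (∈-remove⁻ z∈))
        closed′ : ∀ {z} → z ∈ rest → σ z ∈ rest
        closed′ {z} z∈ with ∈-remove⁻ z∈ | closed (⊆xs z∈)
        ... | _ , z≢σx | here σz≡x = ⊥-elim (z≢σx (trans (sym (invol (⊆xs z∈))) (cong σ σz≡x)))
        ... | z∈xs , _ | there σz∈ = ∈-remove σz∈ (λ σz≡σx → All.lookup x∉ z∈xs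
                                       (trans (sym (invol (here refl))) (trans (cong σ (sym σz≡σx)) (invol (⊆xs z∈)))))
        IH = bounded fuel (ℕ.≤-trans (ℕ.n≤1+n _) (subst (ℕ._≤ fuel) (↭-length xs↭) len≤)) (remove! xs!)
               (closed′ , invol ∘ ⊆xs , free ∘ ⊆xs , product ∘ ⊆xs)
        h = proj₁ IH
        length-eq : suc (length xs) ≡ suc h ℕ.+ suc h
        length-eq = cong suc (trans (↭-length xs↭) (trans (cong suc (proj₁ (proj₂ IH))) (sym (ℕ.+-suc h h))))
        product-eq : x * ∏ xs ≡ c * c ^ h
        product-eq = begin
          x * ∏ xs                 ≡⟨ cong (x *_) (∏-↭ xs↭) ⟩
          x * (σ x * ∏ rest)       ≡⟨ sym (*-assoc _ _ _) ⟩
          (x * σ x) * ∏ rest       ≡⟨ cong₂ _*_ (product (here refl)) (proj₂ (proj₂ IH)) ⟩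
          c * c ^ h                ∎
          where open ≡-Reasoning

  module _ {p} (p-prime : Prime p) (p·1≡0 : p · 1# ≡ 0#) where

    private
      module B = Binomial (CommutativeRing.commutativeSemiring commutativeRing)
      module M = Mult (CommutativeRing.semiring commutativeRing)
      module S = MonoidSum (CommutativeRing.+-monoid commutativeRing)
      module E = Exp (CommutativeRing.semiring commutativeRing)
      open MonoidMult (CommutativeRing.+-monoid commutativeRing) using (×ᵤ≈×)

      ^ₑ≡^ : ∀ x n → x E.^ n ≡ x ^ n
      ^ₑ≡^ x zero = refl
      ^ₑ≡^ x (suc n) = cong (x *_) (^ₑ≡^ x n)

      p∣m⇒m×z≡0 : ∀ {m} z → p ∣ m → m M.× z ≡ 0#
      p∣m⇒m×z≡0 z (divides d refl) = begin
        (d ℕ.* p) M.× z          ≡⟨ cong (M._× z) (ℕ.*-comm d p) ⟩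
        (p ℕ.* d) M.× z          ≡⟨ sym (M.×-assocˡ z p d) ⟩
        p M.× (d M.× z)          ≡⟨ cong (p M.×_) (sym (*-identityˡ _)) ⟩
        p M.× (1# * d M.× z)     ≡⟨ sym (M.×-assoc-* p 1# _) ⟩
        (p M.× 1#) * d M.× z     ≡⟨ cong (_* d M.× z) (trans (×ᵤ≈× p 1#) p·1≡0) ⟩
        0# * d M.× z             ≡⟨ zeroˡ _ ⟩
        0#                       ∎
        where open ≡-Reasoning

      -- All binomial coefficients p C k with 0 < k < p vanish in characteristic p.
      binomial-prime : ∀ m → suc (suc m) ≡ p → ∀ x y → (x + y) ^ p ≡ x ^ p + y ^ p
      binomial-prime m refl x y = begin
        (x + y) ^ p                                             ≡⟨ sym (^ₑ≡^ (x + y) p) ⟩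
        (x + y) E.^ p                                           ≡⟨ B.theorem p x y ⟩
        T Fin.zero + S.sum (λ i → T (Fin.suc i))                ≡⟨ cong (T Fin.zero +_) (S.sum-init-last (λ i → T (Fin.suc i))) ⟩
        T Fin.zero + (S.sum (λ i → T (Fin.suc (inject₁ i))) + T (Fin.suc (fromℕ (suc m))))
          ≡⟨ cong (λ s → T Fin.zero + (s + T (Fin.suc (fromℕ (suc m))))) middle≡0 ⟩
        T Fin.zero + (0# + T (Fin.suc (fromℕ (suc m))))         ≡⟨ cong₂ (λ u v → u + (0# + v)) first last ⟩
        y ^ p + (0# + x ^ p)                                    ≡⟨ cong (y ^ p +_) (+-identityˡ _) ⟩
        y ^ p + x ^ p                                           ≡⟨ +-comm _ _ ⟩
        x ^ p + y ^ p                                           ∎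
        where
        open ≡-Reasoning
        T = B.binomialTerm x y p
        first : T Fin.zero ≡ y ^ p
        first = trans (cong (_+ 0#) (trans (*-identityˡ _) (^ₑ≡^ y p))) (+-identityʳ _)
        last : T (Fin.suc (fromℕ (suc m))) ≡ x ^ p
        last = begin
          T (Fin.suc (fromℕ (suc m)))                 ≡⟨ cong (λ k → (p C k) M.× (x E.^ k * y E.^ (p ℕ.∸ k))) (Fin.toℕ-fromℕ p) ⟩
          (p C p) M.× (x E.^ p * y E.^ (p ℕ.∸ p))     ≡⟨ cong₂ (λ c k → c M.× (x E.^ p * y E.^ k)) (nCn≡1 p) (ℕ.n∸n≡0 p) ⟩
          x E.^ p * 1# + 0#                           ≡⟨ trans (+-identityʳ _) (*-identityʳ _) ⟩
          x E.^ p                                     ≡⟨ ^ₑ≡^ x p ⟩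
          x ^ p                                       ∎
        middle≡0 : S.sum (λ i → T (Fin.suc (inject₁ i))) ≡ 0#
        middle≡0 = trans (S.sum-cong-≗ λ i → p∣m⇒m×z≡0 (B.binomial x y p (Fin.suc (inject₁ i))) (p∣pCk p-prime (s≤s z≤n) (i+1<p i)))
                         (S.sum-replicate-zero (suc m))
          where
          i+1<p : ∀ (i : Fin (suc m)) → suc (toℕ (inject₁ i)) < p
          i+1<p i = s≤s (subst (_< suc m) (sym (Fin.toℕ-inject₁ i)) (Fin.toℕ<n i))

    freshman : ∀ x y → (x + y) ^ p ≡ x ^ p + y ^ p
    freshman = binomial-prime (p ℕ.∸ 2) (ℕ.m+[n∸m]≡n (ℕ.nonTrivial⇒n>1 p {{prime⇒nonTrivial p-prime}}))

    freshman-^ : ∀ j x y → (x + y) ^ (p ℕ.^ j) ≡ x ^ (p ℕ.^ j) + y ^ (p ℕ.^ j)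
    freshman-^ zero x y = trans (*-identityʳ _) (sym (cong₂ _+_ (*-identityʳ x) (*-identityʳ y)))
    freshman-^ (suc j) x y = begin
      (x + y) ^ (p ℕ.* p ℕ.^ j)                     ≡⟨ sym (^-*-assoc (x + y) p (p ℕ.^ j)) ⟩
      ((x + y) ^ p) ^ (p ℕ.^ j)                     ≡⟨ cong (_^ (p ℕ.^ j)) (freshman x y) ⟩
      (x ^ p + y ^ p) ^ (p ℕ.^ j)                   ≡⟨ freshman-^ j (x ^ p) (y ^ p) ⟩
      (x ^ p) ^ (p ℕ.^ j) + (y ^ p) ^ (p ℕ.^ j)     ≡⟨ cong₂ _+_ (^-*-assoc x p (p ℕ.^ j)) (^-*-assoc y p (p ℕ.^ j)) ⟩
      x ^ (p ℕ.* p ℕ.^ j) + y ^ (p ℕ.* p ℕ.^ j)     ∎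
      where open ≡-Reasoning

  module Subfield {p k q : ℕ} (p-prime : Prime p) (p≢2 : ¬ p ≡ 2)
                  (q≡p^k : q ≡ p ℕ.^ k) (size≡q*q : size ≡ q ℕ.* q) where

    q·1≡0 : q · 1# ≡ 0#
    q·1≡0 = reduce (x*y≡0⇒x≡0∨y≡0 (begin
      (q · 1#) * (q · 1#)   ≡⟨ sym (×1-homo-* q q) ⟩
      (q ℕ.* q) · 1#        ≡⟨ cong (_· 1#) (sym size≡q*q) ⟩
      size · 1#             ≡⟨ size·x≡0 1# ⟩
      0#                    ∎))
      where open ≡-Reasoning

    p·1≡0 : p · 1# ≡ 0#
    p·1≡0 = x^n≡0⇒x≡0 k (trans (sym (·1-homo-^ p k)) (trans (cong (_· 1#) (sym q≡p^k)) q·1≡0))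

    2≢0 : ¬ 2# ≡ 0#
    2≢0 2≡0 with p % 2 | m%n<n p 2 | m≡m%n+[m/n]*n p 2
    ... | 0 | _ | p≡[p/2]*2 with prime⇒irreducible p-prime (divides (p / 2) p≡[p/2]*2)
    ...   | inj₁ ()
    ...   | inj₂ 2≡p = p≢2 (sym 2≡p)
    2≢0 2≡0 | 1 | _ | p≡1+[p/2]*2 = 1≢0 (begin
      1#                              ≡⟨ sym (+-identityʳ 1#) ⟩
      1# + 0#                         ≡⟨ cong (1# +_) (sym (trans (cong ((p / 2) · 1# *_) 2≡0) (zeroʳ _))) ⟩
      1# + ((p / 2) · 1#) * 2#        ≡⟨ cong (1# +_) (sym (×1-homo-* (p / 2) 2)) ⟩
      1# + ((p / 2) ℕ.* 2) · 1#       ≡⟨ sym (1+× ((p / 2) ℕ.* 2) 1#) ⟩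
      (1 ℕ.+ (p / 2) ℕ.* 2) · 1#      ≡⟨ cong (_· 1#) (sym p≡1+[p/2]*2) ⟩
      p · 1#                          ≡⟨ p·1≡0 ⟩
      0#                              ∎)
      where open ≡-Reasoning
    2≢0 2≡0 | suc (suc _) | s≤s (s≤s ()) | _

    frob : Carrier → Carrier
    frob x = x ^ q

    frob-+ : ∀ x y → frob (x + y) ≡ frob x + frob y
    frob-+ x y = subst (λ n → (x + y) ^ n ≡ x ^ n + y ^ n) (sym q≡p^k) (freshman-^ p-prime p·1≡0 k x y)

    frob-* : ∀ x y → frob (x * y) ≡ frob x * frob y
    frob-* x y = ^-distribʳ-* x y q

    frob-1 : frob 1# ≡ 1#
    frob-1 = 1^n≡1 q

    frob-0 : frob 0# ≡ 0#
    frob-0 = begin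
      frob 0#                          ≡⟨ solve 1 (λ z → z := (z :+ z) :- z) refl (frob 0#) ⟩
      (frob 0# + frob 0#) - frob 0#    ≡⟨ cong (_- frob 0#) (sym (frob-+ 0# 0#)) ⟩
      frob (0# + 0#) - frob 0#         ≡⟨ cong (λ z → frob z - frob 0#) (+-identityˡ 0#) ⟩
      frob 0# - frob 0#                ≡⟨ -‿inverseʳ _ ⟩
      0#                               ∎
      where open ≡-Reasoning

    frob-‿ : ∀ x → frob (- x) ≡ - frob x
    frob-‿ x = -‿unique (trans (sym (frob-+ x (- x))) (trans (cong frob (-‿inverseʳ x)) frob-0))

    frob-involutive : ∀ x → frob (frob x) ≡ x
    frob-involutive x = trans (^-*-assoc x q q) (trans (cong (x ^_) (sym size≡q*q)) (x^size≡x x))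

    frob-⁻¹ : ∀ x → frob (x ⁻¹) ≡ (frob x) ⁻¹
    frob-⁻¹ x = [ zero-case , unit-case ]′ (toSum (x ≟ 0#))
      where
      zero-case : x ≡ 0# → frob (x ⁻¹) ≡ (frob x) ⁻¹
      zero-case refl = trans (cong frob 0⁻¹≡0) (trans frob-0 (sym (trans (cong _⁻¹ frob-0) 0⁻¹≡0)))
      unit-case : ¬ x ≡ 0# → frob (x ⁻¹) ≡ (frob x) ⁻¹
      unit-case x≢0 = ⁻¹-unique (trans (sym (frob-* x (x ⁻¹))) (trans (cong frob (x*x⁻¹≡1 x≢0)) frob-1))

    InSub-+ : ∀ {x y} → InSub q x → InSub q y → InSub q (x + y)
    InSub-+ {x} {y} fx≡x fy≡y = trans (frob-+ x y) (cong₂ _+_ fx≡x fy≡y)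

    InSub-* : ∀ {x y} → InSub q x → InSub q y → InSub q (x * y)
    InSub-* {x} {y} fx≡x fy≡y = trans (frob-* x y) (cong₂ _*_ fx≡x fy≡y)

    InSub-‿ : ∀ {x} → InSub q x → InSub q (- x)
    InSub-‿ {x} fx≡x = trans (frob-‿ x) (cong -_ fx≡x)

    InSub-⁻¹ : ∀ {x} → InSub q x → InSub q (x ⁻¹)
    InSub-⁻¹ {x} fx≡x = trans (frob-⁻¹ x) (cong _⁻¹ fx≡x)

    InSub-1 : InSub q 1#
    InSub-1 = frob-1

    InSub-2 : InSub q 2#
    InSub-2 = InSub-+ InSub-1 InSub-1

    IsSquare : Carrier → Set
    IsSquare c = ∃ λ y → InSub q y × y * y ≡ c

    isSquare? : ∀ c → Dec (IsSquare c)
    isSquare? c with any? (λ y → (y ^ q ≟ y) ×-dec (y * y ≟ c)) elements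
    ... | yes y∈ = let (y , _ , y-root) = find y∈ in yes (y , y-root)
    ... | no ∄y  = no (λ (y , y-root) → ∄y (lose (complete y) y-root))

    χ₂≡1⇒square : ∀ {c} → χ₂ q c ≡ 1ℤ → IsSquare c
    χ₂≡1⇒square {c} χc≡1 with c ≟ 0#
    ... | yes _ with () ← χc≡1
    ... | no _ with any? (λ y → (y ^ q ≟ y) ×-dec (y * y ≟ c)) elements
    ...   | yes y∈ = let (y , _ , y-root) = find y∈ in y , y-root
    ...   | no _ with () ← χc≡1

    χ₂≡-1⇒≢0 : ∀ {c} → χ₂ q c ≡ -1ℤ → ¬ c ≡ 0#
    χ₂≡-1⇒≢0 {c} χc≡-1 with c ≟ 0#
    ... | yes _ with () ← χc≡-1
    ... | no c≢0 = c≢0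

    χ₂≡-1⇒nonsquare : ∀ {c} → χ₂ q c ≡ -1ℤ → ¬ IsSquare c
    χ₂≡-1⇒nonsquare {c} χc≡-1 (y , y-root) with c ≟ 0#
    ... | yes _ with () ← χc≡-1
    ... | no _ with any? (λ y → (y ^ q ≟ y) ×-dec (y * y ≟ c)) elements
    ...   | yes _ with () ← χc≡-1
    ...   | no ∄y = ∄y (lose (complete y) y-root)

    square⇒χ₂≡1 : ∀ {c} → ¬ c ≡ 0# → IsSquare c → χ₂ q c ≡ 1ℤ
    square⇒χ₂≡1 {c} c≢0 (y , y-root) with c ≟ 0#
    ... | yes c≡0 = ⊥-elim (c≢0 c≡0)
    ... | no _ with any? (λ y → (y ^ q ≟ y) ×-dec (y * y ≟ c)) elements
    ...   | yes _ = refl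
    ...   | no ∄y = ⊥-elim (∄y (lose (complete y) y-root))

    nonsquare⇒χ₂≡-1 : ∀ {c} → ¬ c ≡ 0# → ¬ IsSquare c → χ₂ q c ≡ -1ℤ
    nonsquare⇒χ₂≡-1 {c} c≢0 ¬□c with c ≟ 0#
    ... | yes c≡0 = ⊥-elim (c≢0 c≡0)
    ... | no _ with any? (λ y → (y ^ q ≟ y) ×-dec (y * y ≟ c)) elements
    ...   | yes y∈ = let (y , _ , y-root) = find y∈ in ⊥-elim (¬□c (y , y-root))
    ...   | no _ = refl

    square-* : ∀ {x y} → IsSquare x → IsSquare y → IsSquare (x * y)
    square-* (s , s∈K , s*s≡x) (t , t∈K , t*t≡y) =
      s * t , InSub-* s∈K t∈K , trans (interchange s t s t) (cong₂ _*_ s*s≡x t*t≡y)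

    x≢-x : ∀ {x} → ¬ x ≡ 0# → ¬ x ≡ - x
    x≢-x {x} x≢0 x≡-x = x≢0 (reduce-2x (x*y≡0⇒x≡0∨y≡0 (begin
      2# * x      ≡⟨ solve 1 (λ x → con (ℤ.+ 2) :* x := x :+ x) refl x ⟩
      x + x       ≡⟨ cong (x +_) x≡-x ⟩
      x + - x     ≡⟨ -‿inverseʳ x ⟩
      0#          ∎)))
      where
      open ≡-Reasoning
      reduce-2x : 2# ≡ 0# ⊎ x ≡ 0# → x ≡ 0#
      reduce-2x = [ ⊥-elim ∘ 2≢0 , id ]′

    subUnits : List Carrier
    subUnits = filter (λ x → (x ^ q ≟ x) ×-dec ¬? (x ≟ 0#)) elements

    ∈-subUnits : ∀ {x} → InSub q x → ¬ x ≡ 0# → x ∈ subUnits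
    ∈-subUnits x∈K x≢0 = ∈-filter⁺ _ (complete _) (x∈K , x≢0)

    ∈-subUnits⁻ : ∀ {x} → x ∈ subUnits → InSub q x × ¬ x ≡ 0#
    ∈-subUnits⁻ x∈ = proj₂ (∈-filter⁻ _ {xs = elements} x∈)

    subUnits! : Unique subUnits
    subUnits! = Unique.filter⁺ _ unique

    nonTrivialSubUnits : List Carrier
    nonTrivialSubUnits = remove (- 1#) (remove 1# subUnits)

    ∈-nonTrivialSubUnits⁻ : ∀ {x} → x ∈ nonTrivialSubUnits → (InSub q x × ¬ x ≡ 0#) × ¬ x ≡ 1# × ¬ x ≡ - 1#
    ∈-nonTrivialSubUnits⁻ x∈ with ∈-remove⁻ {xs = remove 1# subUnits} x∈
    ... | x∈′ , x≢-1 with ∈-remove⁻ {xs = subUnits} x∈′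
    ...   | x∈″ , x≢1 = ∈-subUnits⁻ x∈″ , x≢1 , x≢-1

    subUnits↭ : subUnits ↭ 1# ∷ - 1# ∷ nonTrivialSubUnits
    subUnits↭ = ↭-trans (↭-remove subUnits! (∈-subUnits InSub-1 1≢0))
                        (↭-prep 1# (↭-remove (remove! subUnits!)
                          (∈-remove (∈-subUnits (InSub-‿ InSub-1) (-‿≢0 1≢0)) (x≢-x 1≢0 ∘ sym))))

    ⁻¹-paired : Pairing.Paired _⁻¹ 1# nonTrivialSubUnits
    ⁻¹-paired =
        (λ x∈ → let ((x∈K , x≢0) , x≢1 , x≢-1) = ∈-nonTrivialSubUnits⁻ x∈ in
           ∈-remove (∈-remove (∈-subUnits (InSub-⁻¹ x∈K) (⁻¹-≢0 x≢0)) (λ x⁻¹≡1 → x≢1 (⁻¹-injective x≢0 1≢0 (trans x⁻¹≡1 (sym 1⁻¹≡1)))))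
                    (λ x⁻¹≡-1 → x≢-1 (⁻¹-injective x≢0 (-‿≢0 1≢0) (trans x⁻¹≡-1 (sym -1⁻¹≡-1)))))
      , (λ x∈ → ⁻¹-involutive (proj₂ (proj₁ (∈-nonTrivialSubUnits⁻ x∈))))
      , (λ {x} x∈ x⁻¹≡x → let ((_ , x≢0) , x≢1 , x≢-1) = ∈-nonTrivialSubUnits⁻ x∈ in
           [ x≢1 , x≢-1 ]′ (x*x≡y*y⇒x≡±y (trans (cong (x *_) (sym x⁻¹≡x)) (trans (x*x⁻¹≡1 x≢0) (sym (*-identityˡ 1#))))))
      , (λ x∈ → x*x⁻¹≡1 (proj₂ (proj₁ (∈-nonTrivialSubUnits⁻ x∈))))
      where
      1⁻¹≡1 : 1# ⁻¹ ≡ 1#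
      1⁻¹≡1 = sym (⁻¹-unique (*-identityˡ 1#))
      -1⁻¹≡-1 : (- 1#) ⁻¹ ≡ - 1#
      -1⁻¹≡-1 = sym (⁻¹-unique (solve 0 (:- con (ℤ.+ 1) :* :- con (ℤ.+ 1) := con (ℤ.+ 1)) refl))

    -- Wilson: the units other than ±1 pair off with their inverses.
    ∏subUnits≡-1 : ∏ subUnits ≡ - 1#
    ∏subUnits≡-1 = begin
      ∏ subUnits                          ≡⟨ ∏-↭ subUnits↭ ⟩
      1# * (- 1# * ∏ nonTrivialSubUnits)  ≡⟨ cong (λ z → 1# * (- 1# * z)) (trans (proj₂ (proj₂ paired)) (1^n≡1 (proj₁ paired))) ⟩
      1# * (- 1# * 1#)                    ≡⟨ solve 0 (con (ℤ.+ 1) :* (:- con (ℤ.+ 1) :* con (ℤ.+ 1)) := :- con (ℤ.+ 1)) refl ⟩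
      - 1#                                ∎
      where
      open ≡-Reasoning
      paired = Pairing.pairing _⁻¹ 1# (remove! (remove! subUnits!)) ⁻¹-paired

    halfOrder : ℕ
    halfOrder = ℕ.⌊ length subUnits /2⌋

    module _ {c} (c∈K : InSub q c) (c≢0 : ¬ c ≡ 0#) (¬□c : ¬ IsSquare c) where

      x*[c*x⁻¹]≡c : ∀ {x} → ¬ x ≡ 0# → x * (c * x ⁻¹) ≡ c
      x*[c*x⁻¹]≡c {x} x≢0 = trans (solve 3 (λ x c y → x :* (c :* y) := c :* (x :* y)) refl x c (x ⁻¹))
                                  (trans (cong (c *_) (x*x⁻¹≡1 x≢0)) (*-identityʳ c))

      c*[c*x⁻¹]⁻¹≡x : ∀ {x} → ¬ x ≡ 0# → c * (c * x ⁻¹) ⁻¹ ≡ x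
      c*[c*x⁻¹]⁻¹≡x {x} x≢0 = begin
        c * (c * x ⁻¹) ⁻¹        ≡⟨ cong (c *_) (⁻¹-distrib-* c≢0 (⁻¹-≢0 x≢0)) ⟩
        c * (c ⁻¹ * x ⁻¹ ⁻¹)     ≡⟨ cong (λ z → c * (c ⁻¹ * z)) (⁻¹-involutive x≢0) ⟩
        c * (c ⁻¹ * x)           ≡⟨ sym (*-assoc _ _ _) ⟩
        (c * c ⁻¹) * x           ≡⟨ cong (_* x) (x*x⁻¹≡1 c≢0) ⟩
        1# * x                   ≡⟨ *-identityˡ x ⟩
        x                        ∎
        where open ≡-Reasoning

      c/x-paired : Pairing.Paired (λ x → c * x ⁻¹) c subUnits
      c/x-paired =
          (λ x∈ → let (x∈K , x≢0) = ∈-subUnits⁻ x∈ in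
             ∈-subUnits (InSub-* c∈K (InSub-⁻¹ x∈K)) (*-≢0 c≢0 (⁻¹-≢0 x≢0)))
        , (λ x∈ → c*[c*x⁻¹]⁻¹≡x (proj₂ (∈-subUnits⁻ x∈)))
        , (λ {x} x∈ c/x≡x → let (x∈K , x≢0) = ∈-subUnits⁻ x∈ in
             ¬□c (x , x∈K , trans (cong (x *_) (sym c/x≡x)) (x*[c*x⁻¹]≡c x≢0)))
        , (λ x∈ → x*[c*x⁻¹]≡c (proj₂ (∈-subUnits⁻ x∈)))

      -- Euler's criterion for non-squares: pairing x with c / x gives ∏ subUnits ≡ c ^ halfOrder.
      nonsquare^halfOrder≡-1 : c ^ halfOrder ≡ - 1#
      nonsquare^halfOrder≡-1 = begin
        c ^ ℕ.⌊ length subUnits /2⌋     ≡⟨ cong (λ n → c ^ ℕ.⌊ n /2⌋) (proj₁ (proj₂ paired)) ⟩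
        c ^ ℕ.⌊ h ℕ.+ h /2⌋             ≡⟨ cong (c ^_) (sym (ℕ.n≡⌊n+n/2⌋ h)) ⟩
        c ^ h                           ≡⟨ sym (proj₂ (proj₂ paired)) ⟩
        ∏ subUnits                      ≡⟨ ∏subUnits≡-1 ⟩
        - 1#                            ∎
        where
        open ≡-Reasoning
        paired = Pairing.pairing (λ x → c * x ⁻¹) c subUnits! c/x-paired
        h = proj₁ paired

    nonsquare-*-nonsquare : ∀ {x y} → InSub q x → InSub q y → ¬ x ≡ 0# → ¬ y ≡ 0# →
                            ¬ IsSquare x → ¬ IsSquare y → IsSquare (x * y)
    nonsquare-*-nonsquare {x} {y} x∈K y∈K x≢0 y≢0 ¬□x ¬□y = decidable-stable (isSquare? (x * y)) λ ¬□xy →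
      x≢-x 1≢0 (begin
        1#                                ≡⟨ solve 0 (con (ℤ.+ 1) := :- con (ℤ.+ 1) :* :- con (ℤ.+ 1)) refl ⟩
        - 1# * - 1#                       ≡⟨ sym (cong₂ _*_ (nonsquare^halfOrder≡-1 x∈K x≢0 ¬□x) (nonsquare^halfOrder≡-1 y∈K y≢0 ¬□y)) ⟩
        x ^ halfOrder * y ^ halfOrder     ≡⟨ sym (^-distribʳ-* x y halfOrder) ⟩
        (x * y) ^ halfOrder               ≡⟨ nonsquare^halfOrder≡-1 (InSub-* x∈K y∈K) (*-≢0 x≢0 y≢0) ¬□xy ⟩
        - 1#                              ∎)
      where open ≡-Reasoning

    square-*-square : ∀ {x t} → IsSquare x → InSub q t → IsSquare (x * (t * t))
    square-*-square □x t∈K = square-* □x (_ , t∈K , refl)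

    square-*⇒square-*⁻¹ : ∀ {x t} → InSub q t → ¬ t ≡ 0# → IsSquare (x * t) → IsSquare (x * t ⁻¹)
    square-*⇒square-*⁻¹ {x} {t} t∈K t≢0 □xt = subst IsSquare (begin
      (x * t) * (t ⁻¹ * t ⁻¹)    ≡⟨ solve 3 (λ x t s → (x :* t) :* (s :* s) := (x :* s) :* (t :* s)) refl x t (t ⁻¹) ⟩
      (x * t ⁻¹) * (t * t ⁻¹)    ≡⟨ cong ((x * t ⁻¹) *_) (x*x⁻¹≡1 t≢0) ⟩
      (x * t ⁻¹) * 1#            ≡⟨ *-identityʳ _ ⟩
      x * t ⁻¹                   ∎) (square-*-square □xt (InSub-⁻¹ t∈K))
      where open ≡-Reasoning

    square-*⁻¹⇒square-* : ∀ {x t} → InSub q t → ¬ t ≡ 0# → IsSquare (x * t ⁻¹) → IsSquare (x * t)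
    square-*⁻¹⇒square-* {x} {t} t∈K t≢0 □xt⁻¹ = subst IsSquare (begin
      (x * t ⁻¹) * (t * t)       ≡⟨ solve 3 (λ x t s → (x :* s) :* (t :* t) := (x :* t) :* (t :* s)) refl x t (t ⁻¹) ⟩
      (x * t) * (t * t ⁻¹)       ≡⟨ cong ((x * t) *_) (x*x⁻¹≡1 t≢0) ⟩
      (x * t) * 1#               ≡⟨ *-identityʳ _ ⟩
      x * t                      ∎) (square-*-square □xt⁻¹ t∈K)
      where open ≡-Reasoning

    ±_ : Carrier → List Carrier
    ± s = s ∷ - s ∷ []

    ±-unique : ∀ {s} → ¬ s ≡ 0# → Unique (± s)
    ±-unique s≢0 = (x≢-x s≢0 ∷ []) ∷ [] ∷ []

    ∈±⇔square≡ : ∀ {s x} → x ∈ ± s ⇔ x * x ≡ s * s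
    ∈±⇔square≡ {s} = mk⇔
      (λ { (here refl) → refl ; (there (here refl)) → solve 1 (λ s → :- s :* :- s := s :* s) refl s })
      ([ here , there ∘ here ]′ ∘ x*x≡y*y⇒x≡±y)

    -- A square root y of -1 has y ^ 4 ≡ 1#, so frob y only depends on q mod 4.
    frob-√-1 : ∀ {y} → y * y ≡ - 1# → frob y ≡ y ^ (q % 4)
    frob-√-1 {y} y*y≡-1 = begin
      y ^ q                                ≡⟨ cong (y ^_) (m≡m%n+[m/n]*n q 4) ⟩
      y ^ (q % 4 ℕ.+ (q / 4) ℕ.* 4)        ≡⟨ ^-distribˡ-+-* y (q % 4) _ ⟩
      y ^ (q % 4) * y ^ ((q / 4) ℕ.* 4)    ≡⟨ cong (λ n → y ^ (q % 4) * y ^ n) (ℕ.*-comm (q / 4) 4) ⟩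
      y ^ (q % 4) * y ^ (4 ℕ.* (q / 4))    ≡⟨ cong (y ^ (q % 4) *_) (sym (^-*-assoc y 4 (q / 4))) ⟩
      y ^ (q % 4) * (y ^ 4) ^ (q / 4)      ≡⟨ cong (λ z → y ^ (q % 4) * z ^ (q / 4)) y^4≡1 ⟩
      y ^ (q % 4) * 1# ^ (q / 4)           ≡⟨ cong (y ^ (q % 4) *_) (1^n≡1 (q / 4)) ⟩
      y ^ (q % 4) * 1#                     ≡⟨ *-identityʳ _ ⟩
      y ^ (q % 4)                          ∎
      where
      open ≡-Reasoning
      y^4≡1 : y ^ 4 ≡ 1#
      y^4≡1 = begin
        y ^ 4                  ≡⟨ solve 1 (λ y → y :* (y :* (y :* (y :* con (ℤ.+ 1)))) := (y :* y) :* (y :* y)) refl y ⟩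
        (y * y) * (y * y)      ≡⟨ cong₂ _*_ y*y≡-1 y*y≡-1 ⟩
        - 1# * - 1#            ≡⟨ solve 0 (:- con (ℤ.+ 1) :* :- con (ℤ.+ 1) := con (ℤ.+ 1)) refl ⟩
        1#                     ∎

    -1-nonsquare : q % 4 ≡ 3 → ¬ IsSquare (- 1#)
    -1-nonsquare q%4≡3 (y , y∈K , y*y≡-1) = x≢-x (x*x≡c⇒x≢0 (-‿≢0 1≢0) y*y≡-1) (begin
      y                    ≡⟨ sym y∈K ⟩
      frob y               ≡⟨ frob-√-1 y*y≡-1 ⟩
      y ^ (q % 4)          ≡⟨ cong (y ^_) q%4≡3 ⟩
      y * (y * (y * 1#))   ≡⟨ solve 1 (λ y → y :* (y :* (y :* con (ℤ.+ 1))) := (y :* y) :* y) refl y ⟩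
      (y * y) * y          ≡⟨ cong (_* y) y*y≡-1 ⟩
      - 1# * y             ≡⟨ -1*x≈-x y ⟩
      - y                  ∎)
      where open ≡-Reasoning

    subRoots : ∀ {c} → Dec (IsSquare c) → List Carrier
    subRoots (yes (s , _)) = ± s
    subRoots (no _)        = []

    subRoots! : ∀ {c} → ¬ c ≡ 0# → (d : Dec (IsSquare c)) → Unique (subRoots d)
    subRoots! c≢0 (yes (s , _ , s*s≡c)) = ±-unique (x*x≡c⇒x≢0 c≢0 s*s≡c)
    subRoots! c≢0 (no _)                = []

    ∈-subRoots⇔ : ∀ {c x} (d : Dec (IsSquare c)) → x ∈ subRoots d ⇔ (InSub q x × x * x ≡ c)
    ∈-subRoots⇔ {c} {x} (yes (s , s∈K , s*s≡c)) = mk⇔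
      (λ { (here refl) → s∈K , s*s≡c
         ; (there (here refl)) → InSub-‿ s∈K , trans (Equivalence.to ∈±⇔square≡ (there (here refl))) s*s≡c })
      (λ (_ , x*x≡c) → Equivalence.from ∈±⇔square≡ (trans x*x≡c (sym s*s≡c)))
    ∈-subRoots⇔ (no ¬□c) = mk⇔ (λ ()) (λ (x∈K , x*x≡c) → ⊥-elim (¬□c (_ , x∈K , x*x≡c)))

    module QuadraticExtension {b β} (b∈K : InSub q b) (χb≡-1 : χ₂ q b ≡ -1ℤ) (β*β≡b : β * β ≡ b) where

      b≢0 : ¬ b ≡ 0#
      b≢0 = χ₂≡-1⇒≢0 χb≡-1

      b-nonsquare : ¬ IsSquare b
      b-nonsquare = χ₂≡-1⇒nonsquare χb≡-1

      frob-β : frob β ≡ - β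
      frob-β with x*x≡y*y⇒x≡±y (trans (sym (frob-* β β)) (trans (cong frob β*β≡b) (trans b∈K (sym β*β≡b))))
      ... | inj₁ β∈K = ⊥-elim (b-nonsquare (β , β∈K , β*β≡b))
      ... | inj₂ frobβ≡-β = frobβ≡-β

      AntiInvariant : Carrier → Set
      AntiInvariant X = frob X ≡ - X

      -- For a non-square c, c * b = r * r with r ∈ K, and X = r * β * b ⁻¹ has X * X ≡ c.
      nonsquare⇒antiRoot : ∀ {c} → InSub q c → ¬ c ≡ 0# → ¬ IsSquare c → ∃ λ X → AntiInvariant X × X * X ≡ c
      nonsquare⇒antiRoot {c} c∈K c≢0 ¬□c = r * β * b ⁻¹ , frob-X , X*X≡c
        where
        open ≡-Reasoning
        □cb : IsSquare (c * b)
        □cb = nonsquare-*-nonsquare c∈K b∈K c≢0 b≢0 ¬□c b-nonsquare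
        r = proj₁ □cb
        r∈K = proj₁ (proj₂ □cb)
        r*r≡cb = proj₂ (proj₂ □cb)
        frob-X : AntiInvariant (r * β * b ⁻¹)
        frob-X = begin
          frob (r * β * b ⁻¹)                  ≡⟨ trans (frob-* _ _) (cong (_* frob (b ⁻¹)) (frob-* r β)) ⟩
          frob r * frob β * frob (b ⁻¹)        ≡⟨ cong₂ (λ u v → u * frob β * v) r∈K (InSub-⁻¹ b∈K) ⟩
          r * frob β * b ⁻¹                    ≡⟨ cong (λ v → r * v * b ⁻¹) frob-β ⟩
          r * - β * b ⁻¹                       ≡⟨ solve 3 (λ r β i → r :* :- β :* i := :- (r :* β :* i)) refl r β (b ⁻¹) ⟩
          - (r * β * b ⁻¹)                     ∎
        X*X≡c : (r * β * b ⁻¹) * (r * β * b ⁻¹) ≡ c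
        X*X≡c = begin
          (r * β * b ⁻¹) * (r * β * b ⁻¹)      ≡⟨ interchange (r * β) (b ⁻¹) (r * β) (b ⁻¹) ⟩
          (r * β) * (r * β) * (b ⁻¹ * b ⁻¹)    ≡⟨ cong (_* (b ⁻¹ * b ⁻¹)) (interchange r β r β) ⟩
          (r * r) * (β * β) * (b ⁻¹ * b ⁻¹)    ≡⟨ cong₂ (λ u v → u * v * (b ⁻¹ * b ⁻¹)) r*r≡cb β*β≡b ⟩
          (c * b) * b * (b ⁻¹ * b ⁻¹)          ≡⟨ trans (cong (_* (b ⁻¹ * b ⁻¹)) (*-assoc c b b)) (*-assoc c (b * b) _) ⟩
          c * ((b * b) * (b ⁻¹ * b ⁻¹))        ≡⟨ cong (c *_) (interchange b b (b ⁻¹) (b ⁻¹)) ⟩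
          c * ((b * b ⁻¹) * (b * b ⁻¹))        ≡⟨ cong (λ u → c * (u * u)) (x*x⁻¹≡1 b≢0) ⟩
          c * (1# * 1#)                        ≡⟨ cong (c *_) (*-identityˡ 1#) ⟩
          c * 1#                               ≡⟨ *-identityʳ c ⟩
          c                                    ∎

      -1-square : q % 4 ≡ 1 → IsSquare (- 1#)
      -1-square q%4≡1 = decidable-stable (isSquare? (- 1#)) λ ¬□-1 →
        let (i , frob-i≡-i , i*i≡-1) = nonsquare⇒antiRoot (InSub-‿ InSub-1) (-‿≢0 1≢0) ¬□-1
        in x≢-x (x*x≡c⇒x≢0 (-‿≢0 1≢0) i*i≡-1) (begin
          i            ≡⟨ sym (*-identityʳ i) ⟩
          i ^ 1        ≡⟨ cong (i ^_) (sym q%4≡1) ⟩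
          i ^ (q % 4)  ≡⟨ sym (frob-√-1 i*i≡-1) ⟩
          frob i       ≡⟨ frob-i≡-i ⟩
          - i          ∎)
        where open ≡-Reasoning

      sub∧anti⇒≡0 : ∀ {x} → InSub q x → AntiInvariant x → x ≡ 0#
      sub∧anti⇒≡0 {x} x∈K frob-x≡-x = decidable-stable (x ≟ 0#) (λ x≢0 → x≢-x x≢0 (trans (sym x∈K) frob-x≡-x))

      module _ {c} (c∈K : InSub q c) (c≢0 : ¬ c ≡ 0#) where

        antiRoots : Dec (IsSquare c) → List Carrier
        antiRoots (yes _)  = []
        antiRoots (no ¬□c) = ± proj₁ (nonsquare⇒antiRoot c∈K c≢0 ¬□c)

        antiRoots! : (d : Dec (IsSquare c)) → Unique (antiRoots d)
        antiRoots! (yes _)  = []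
        antiRoots! (no ¬□c) = ±-unique (x*x≡c⇒x≢0 c≢0 (proj₂ (proj₂ (nonsquare⇒antiRoot c∈K c≢0 ¬□c))))

        ∈-antiRoots⇔ : ∀ {x} (d : Dec (IsSquare c)) → x ∈ antiRoots d ⇔ (AntiInvariant x × x * x ≡ c)
        ∈-antiRoots⇔ {x} (yes □c@(s , _ , s*s≡c)) = mk⇔ (λ ()) (λ (anti , x*x≡c) →
          let x∈K = proj₁ (Equivalence.to (∈-subRoots⇔ (yes □c)) (Equivalence.from ∈±⇔square≡ (trans x*x≡c (sym s*s≡c))))
          in ⊥-elim (x*x≡c⇒x≢0 c≢0 x*x≡c (sub∧anti⇒≡0 x∈K anti)))
        ∈-antiRoots⇔ {x} (no ¬□c) = mk⇔
          (λ { (here refl) → anti , X*X≡c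
             ; (there (here refl)) → trans (frob-‿ X) (cong -_ anti) , trans (Equivalence.to ∈±⇔square≡ (there (here refl))) X*X≡c })
          (λ (_ , x*x≡c) → Equivalence.from ∈±⇔square≡ (trans x*x≡c (sym X*X≡c)))
          where
          X = proj₁ (nonsquare⇒antiRoot c∈K c≢0 ¬□c)
          anti = proj₁ (proj₂ (nonsquare⇒antiRoot c∈K c≢0 ¬□c))
          X*X≡c = proj₂ (proj₂ (nonsquare⇒antiRoot c∈K c≢0 ¬□c))

      frob-coordinates : ∀ {u v} → InSub q u → InSub q v → frob (u + v * β) ≡ u - v * β
      frob-coordinates {u} {v} u∈K v∈K = begin
        frob (u + v * β)          ≡⟨ trans (frob-+ u (v * β)) (cong (frob u +_) (frob-* v β)) ⟩
        frob u + frob v * frob β  ≡⟨ cong₂ (λ s t → s + t * frob β) u∈K v∈K ⟩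
        u + v * frob β            ≡⟨ cong (λ t → u + v * t) frob-β ⟩
        u + v * - β               ≡⟨ cong (u +_) (sym (-‿distribʳ-* v β)) ⟩
        u - v * β                 ∎
        where open ≡-Reasoning

      coordinates-≡0 : ∀ {u v} → InSub q u → InSub q v → u + v * β ≡ 0# → u ≡ 0# × v ≡ 0#
      coordinates-≡0 {u} {v} u∈K v∈K u+vβ≡0 with v ≟ 0#
      ... | yes v≡0 = u≡0 , v≡0
        where
        open ≡-Reasoning
        u≡0 = begin
          u              ≡⟨ sym (+-identityʳ u) ⟩
          u + 0#         ≡⟨ cong (u +_) (sym (zeroˡ β)) ⟩
          u + 0# * β     ≡⟨ cong (λ t → u + t * β) (sym v≡0) ⟩
          u + v * β      ≡⟨ u+vβ≡0 ⟩
          0#             ∎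
      ... | no v≢0 = ⊥-elim (b-nonsquare (- u * v ⁻¹ , InSub-* (InSub-‿ u∈K) (InSub-⁻¹ v∈K) , trans (cong (λ t → t * t) β≡-u/v) β*β≡b))
        where
        open ≡-Reasoning
        β≡-u/v : - u * v ⁻¹ ≡ β
        β≡-u/v = begin
          - u * v ⁻¹          ≡⟨ cong (_* v ⁻¹) (sym (-‿unique u+vβ≡0)) ⟩
          (v * β) * v ⁻¹      ≡⟨ solve 3 (λ v β w → (v :* β) :* w := β :* (v :* w)) refl v β (v ⁻¹) ⟩
          β * (v * v ⁻¹)      ≡⟨ cong (β *_) (x*x⁻¹≡1 v≢0) ⟩
          β * 1#              ≡⟨ *-identityʳ β ⟩
          β                   ∎

      -- u = (X + frob X) / 2 and v = (X - frob X) / (2 β) = (X - frob X) β / (2 b).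
      coordinates : ∀ X → ∃₂ λ u v → InSub q u × InSub q v × X ≡ u + v * β
      coordinates X = (X + F) * h , (X - F) * (β * w) , u∈K , v∈K , X≡u+vβ
        where
        open ≡-Reasoning
        F = frob X
        h = 2# ⁻¹
        w = (2# * b) ⁻¹
        frob-F : frob F ≡ X
        frob-F = frob-involutive X
        u∈K : InSub q ((X + F) * h)
        u∈K = begin
          frob ((X + F) * h)         ≡⟨ trans (frob-* _ h) (cong₂ _*_ (frob-+ X F) (InSub-⁻¹ InSub-2)) ⟩
          (F + frob F) * h           ≡⟨ cong (λ t → (F + t) * h) frob-F ⟩
          (F + X) * h                ≡⟨ cong (_* h) (+-comm F X) ⟩
          (X + F) * h                ∎
        v∈K : InSub q ((X - F) * (β * w))
        v∈K = begin
          frob ((X - F) * (β * w))               ≡⟨ trans (frob-* _ _) (cong₂ _*_ (frob-+ X (- F)) (frob-* β w)) ⟩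
          (F + frob (- F)) * (frob β * frob w)   ≡⟨ cong₂ (λ s t → (F + s) * (t * frob w)) (trans (frob-‿ F) (cong -_ frob-F)) frob-β ⟩
          (F - X) * (- β * frob w)               ≡⟨ cong (λ t → (F - X) * (- β * t)) (InSub-⁻¹ (InSub-* InSub-2 b∈K)) ⟩
          (F - X) * (- β * w)                    ≡⟨ solve 4 (λ X F β w → (F :- X) :* (:- β :* w) := (X :- F) :* (β :* w)) refl X F β w ⟩
          (X - F) * (β * w)                      ∎
        b*w≡h : b * w ≡ h
        b*w≡h = begin
          b * (2# * b) ⁻¹            ≡⟨ cong (b *_) (⁻¹-distrib-* 2≢0 b≢0) ⟩
          b * (2# ⁻¹ * b ⁻¹)         ≡⟨ solve 3 (λ b h c → b :* (h :* c) := h :* (b :* c)) refl b h (b ⁻¹) ⟩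
          h * (b * b ⁻¹)             ≡⟨ cong (h *_) (x*x⁻¹≡1 b≢0) ⟩
          h * 1#                     ≡⟨ *-identityʳ h ⟩
          h                          ∎
        X≡u+vβ : X ≡ (X + F) * h + (X - F) * (β * w) * β
        X≡u+vβ = sym (begin
          (X + F) * h + (X - F) * (β * w) * β    ≡⟨ solve 5 (λ X F h β w → (X :+ F) :* h :+ (X :- F) :* (β :* w) :* β
                                                               := (X :+ F) :* h :+ (X :- F) :* ((β :* β) :* w)) refl X F h β w ⟩
          (X + F) * h + (X - F) * ((β * β) * w)  ≡⟨ cong (λ t → (X + F) * h + (X - F) * (t * w)) β*β≡b ⟩
          (X + F) * h + (X - F) * (b * w)        ≡⟨ cong (λ t → (X + F) * h + (X - F) * t) b*w≡h ⟩
          (X + F) * h + (X - F) * h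
            ≡⟨ solve 3 (λ X F h → (X :+ F) :* h :+ (X :- F) :* h := X :* (con (ℤ.+ 2) :* h)) refl X F h ⟩
          X * (2# * h)                           ≡⟨ cong (X *_) (x*x⁻¹≡1 2≢0) ⟩
          X * 1#                                 ≡⟨ *-identityʳ X ⟩
          X                                      ∎)

      module Preimages {a} (a∈K : InSub q a) (a≢0 : ¬ a ≡ 0#) (a≢1 : ¬ a ≡ 1#) (a≢-1 : ¬ a ≡ - 1#)
                       {α} (α∈K : InSub q α) (α≢0 : ¬ α ≡ 0#) where

        f : Carrier → Carrier
        f X = X ^ suc q + a * (X * X)

        a+1≢0 : ¬ a + 1# ≡ 0#
        a+1≢0 a+1≡0 = a≢-1 (trans (sym (-‿involutive a)) (cong -_ (sym (-‿unique a+1≡0))))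

        a-1≢0 : ¬ a - 1# ≡ 0#
        a-1≢0 = a≢1 ∘ x-y≡0⇒x≡y

        a+1∈K : InSub q (a + 1#)
        a+1∈K = InSub-+ a∈K InSub-1

        a-1∈K : InSub q (a - 1#)
        a-1∈K = InSub-+ a∈K (InSub-‿ InSub-1)

        f-sub : ∀ {X} → InSub q X → f X ≡ (a + 1#) * (X * X)
        f-sub {X} X∈K = trans (cong (λ t → X * t + a * (X * X)) X∈K)
                              (solve 2 (λ X a → X :* X :+ a :* (X :* X) := (a :+ con (ℤ.+ 1)) :* (X :* X)) refl X a)

        f-anti : ∀ {X} → AntiInvariant X → f X ≡ (a - 1#) * (X * X)
        f-anti {X} anti = trans (cong (λ t → X * t + a * (X * X)) anti)
                                (solve 2 (λ X a → X :* :- X :+ a :* (X :* X) := (a :- con (ℤ.+ 1)) :* (X :* X)) refl X a)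

        -- X * frob X and α lie in K, hence so does a * X * X, and (frob X)² = frob (X * X) = X * X.
        f≡α⇒frob≡± : ∀ {X} → f X ≡ α → frob X ≡ X ⊎ frob X ≡ - X
        f≡α⇒frob≡± {X} fX≡α = x*x≡y*y⇒x≡±y (trans (sym (frob-* X X)) X*X∈K)
          where
          N = X * frob X
          N∈K : InSub q N
          N∈K = trans (frob-* X (frob X)) (trans (cong (frob X *_) (frob-involutive X)) (*-comm _ _))
          X*X≡ : X * X ≡ (α - N) * a ⁻¹
          X*X≡ = x*y≡z⇒y≡z*x⁻¹ a≢0 (begin
            a * (X * X)              ≡⟨ solve 2 (λ n m → m := (n :+ m) :- n) refl N (a * (X * X)) ⟩
            (N + a * (X * X)) - N    ≡⟨ cong (_- N) fX≡α ⟩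
            α - N                    ∎)
            where open ≡-Reasoning
          X*X∈K : InSub q (X * X)
          X*X∈K = subst (InSub q) (sym X*X≡) (InSub-* (InSub-+ α∈K (InSub-‿ N∈K)) (InSub-⁻¹ a∈K))

        c₊ c₋ : Carrier
        c₊ = α * (a + 1#) ⁻¹
        c₋ = α * (a - 1#) ⁻¹

        f≡α⇔ : ∀ {X} → f X ≡ α ⇔ ((InSub q X × X * X ≡ c₊) ⊎ (AntiInvariant X × X * X ≡ c₋))
        f≡α⇔ {X} = mk⇔
          (λ fX≡α → [ (λ X∈K → inj₁ (X∈K , x*y≡z⇒y≡z*x⁻¹ a+1≢0 (trans (sym (f-sub X∈K)) fX≡α)))
                    , (λ anti → inj₂ (anti , x*y≡z⇒y≡z*x⁻¹ a-1≢0 (trans (sym (f-anti anti)) fX≡α))) ]′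
                    (f≡α⇒frob≡± fX≡α))
          [ (λ (X∈K , X*X≡c₊) → trans (f-sub X∈K) (y≡z*x⁻¹⇒x*y≡z a+1≢0 X*X≡c₊))
          , (λ (anti , X*X≡c₋) → trans (f-anti anti) (y≡z*x⁻¹⇒x*y≡z a-1≢0 X*X≡c₋)) ]′

        c₋∈K : InSub q c₋
        c₋∈K = InSub-* α∈K (InSub-⁻¹ a-1∈K)

        c₊≢0 : ¬ c₊ ≡ 0#
        c₊≢0 = *-≢0 α≢0 (⁻¹-≢0 a+1≢0)

        c₋≢0 : ¬ c₋ ≡ 0#
        c₋≢0 = *-≢0 α≢0 (⁻¹-≢0 a-1≢0)

        preimageCount-α : (d₊ : Dec (IsSquare c₊)) (d₋ : Dec (IsSquare c₋)) →
                          preimageCount f α ≡ length (subRoots d₊ ++ antiRoots c₋∈K c₋≢0 d₋)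
        preimageCount-α d₊ d₋ = length-filter-complete (λ X → f X ≟ α) complete unique
          (Unique.++⁺ (subRoots! c₊≢0 d₊) (antiRoots! c₋∈K c₋≢0 d₋) disjoint)
          (λ {X} → mk⇔
            (Equivalence.from ++-∈⇔ ∘ Sum.map (Equivalence.from (∈-subRoots⇔ d₊)) (Equivalence.from ∈-antiRoots)
                                   ∘ Equivalence.to f≡α⇔)
            (Equivalence.from f≡α⇔ ∘ Sum.map (Equivalence.to (∈-subRoots⇔ d₊)) (Equivalence.to ∈-antiRoots)
                                   ∘ Equivalence.to ++-∈⇔))
          where
          ∈-antiRoots : ∀ {X} → X ∈ antiRoots c₋∈K c₋≢0 d₋ ⇔ (AntiInvariant X × X * X ≡ c₋)
          ∈-antiRoots = ∈-antiRoots⇔ c₋∈K c₋≢0 d₋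
          disjoint : ∀ {X} → ¬ (X ∈ subRoots d₊ × X ∈ antiRoots c₋∈K c₋≢0 d₋)
          disjoint (X∈₊ , X∈₋) =
            let (X∈K , X*X≡c₊) = Equivalence.to (∈-subRoots⇔ d₊) X∈₊
                (anti , _) = Equivalence.to ∈-antiRoots X∈₋
            in x*x≡c⇒x≢0 c₊≢0 X*X≡c₊ (sub∧anti⇒≡0 X∈K anti)

        part₁ : (χ₂ q (α * (a - 1#)) ≡ 1ℤ → χ₂ q (α * (a + 1#)) ≡ -1ℤ → preimageCount f α ≡ 0)
              × (χ₂ q (α * (a - 1#)) ≡ -1ℤ → χ₂ q (α * (a + 1#)) ≡ 1ℤ → preimageCount f α ≡ 4)
              × (¬ (χ₂ q (α * (a - 1#)) ≡ 1ℤ × χ₂ q (α * (a + 1#)) ≡ -1ℤ) →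
                 ¬ (χ₂ q (α * (a - 1#)) ≡ -1ℤ × χ₂ q (α * (a + 1#)) ≡ 1ℤ) →
                 preimageCount f α ≡ 2)
        part₁ = (λ χ₋≡1 χ₊≡-1 → preimageCount-α (no (¬□₊ χ₊≡-1)) (yes (□₋ χ₋≡1)))
              , (λ χ₋≡-1 χ₊≡1 → preimageCount-α (yes (□₊ χ₊≡1)) (no (¬□₋ χ₋≡-1)))
              , λ ¬[1,-1] ¬[-1,1] → equal-characters ¬[1,-1] ¬[-1,1] (isSquare? c₊) (isSquare? c₋)
          where
          □₊ : χ₂ q (α * (a + 1#)) ≡ 1ℤ → IsSquare c₊
          □₊ = square-*⇒square-*⁻¹ a+1∈K a+1≢0 ∘ χ₂≡1⇒square
          □₋ : χ₂ q (α * (a - 1#)) ≡ 1ℤ → IsSquare c₋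
          □₋ = square-*⇒square-*⁻¹ a-1∈K a-1≢0 ∘ χ₂≡1⇒square
          ¬□₊ : χ₂ q (α * (a + 1#)) ≡ -1ℤ → ¬ IsSquare c₊
          ¬□₊ χ≡-1 = χ₂≡-1⇒nonsquare χ≡-1 ∘ square-*⁻¹⇒square-* a+1∈K a+1≢0
          ¬□₋ : χ₂ q (α * (a - 1#)) ≡ -1ℤ → ¬ IsSquare c₋
          ¬□₋ χ≡-1 = χ₂≡-1⇒nonsquare χ≡-1 ∘ square-*⁻¹⇒square-* a-1∈K a-1≢0
          χ₊≡1 : IsSquare c₊ → χ₂ q (α * (a + 1#)) ≡ 1ℤ
          χ₊≡1 = square⇒χ₂≡1 (*-≢0 α≢0 a+1≢0) ∘ square-*⁻¹⇒square-* a+1∈K a+1≢0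
          χ₋≡1 : IsSquare c₋ → χ₂ q (α * (a - 1#)) ≡ 1ℤ
          χ₋≡1 = square⇒χ₂≡1 (*-≢0 α≢0 a-1≢0) ∘ square-*⁻¹⇒square-* a-1∈K a-1≢0
          χ₊≡-1 : ¬ IsSquare c₊ → χ₂ q (α * (a + 1#)) ≡ -1ℤ
          χ₊≡-1 ¬□c₊ = nonsquare⇒χ₂≡-1 (*-≢0 α≢0 a+1≢0) (¬□c₊ ∘ square-*⇒square-*⁻¹ a+1∈K a+1≢0)
          χ₋≡-1 : ¬ IsSquare c₋ → χ₂ q (α * (a - 1#)) ≡ -1ℤ
          χ₋≡-1 ¬□c₋ = nonsquare⇒χ₂≡-1 (*-≢0 α≢0 a-1≢0) (¬□c₋ ∘ square-*⇒square-*⁻¹ a-1∈K a-1≢0)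
          equal-characters : ¬ (χ₂ q (α * (a - 1#)) ≡ 1ℤ × χ₂ q (α * (a + 1#)) ≡ -1ℤ) →
                             ¬ (χ₂ q (α * (a - 1#)) ≡ -1ℤ × χ₂ q (α * (a + 1#)) ≡ 1ℤ) →
                             (d₊ : Dec (IsSquare c₊)) (d₋ : Dec (IsSquare c₋)) → preimageCount f α ≡ 2
          equal-characters _ _ (yes □c₊) (yes □c₋) = preimageCount-α (yes □c₊) (yes □c₋)
          equal-characters _ _ (no ¬□c₊) (no ¬□c₋) = preimageCount-α (no ¬□c₊) (no ¬□c₋)
          equal-characters _ ¬[-1,1] (yes □c₊) (no ¬□c₋) = ⊥-elim (¬[-1,1] (χ₋≡-1 ¬□c₋ , χ₊≡1 □c₊))
          equal-characters ¬[1,-1] _ (no ¬□c₊) (yes □c₋) = ⊥-elim (¬[1,-1] (χ₋≡1 □c₋ , χ₊≡-1 ¬□c₊))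

        A B : Carrier → Carrier → Carrier
        A u v = (a + 1#) * (u * u) + (a - 1#) * b * (v * v)
        B u v = 2# * a * u * v

        f-coordinates : ∀ {u v} → InSub q u → InSub q v → f (u + v * β) ≡ A u v + B u v * β
        f-coordinates {u} {v} u∈K v∈K = begin
          (u + v * β) * frob (u + v * β) + a * ((u + v * β) * (u + v * β))
            ≡⟨ cong (λ t → (u + v * β) * t + a * ((u + v * β) * (u + v * β))) (frob-coordinates u∈K v∈K) ⟩
          (u + v * β) * (u - v * β) + a * ((u + v * β) * (u + v * β))
            ≡⟨ solve 4 (λ u v β a → (u :+ v :* β) :* (u :- v :* β) :+ a :* ((u :+ v :* β) :* (u :+ v :* β))
                                   := (a :+ con (ℤ.+ 1)) :* (u :* u) :+ (a :- con (ℤ.+ 1)) :* (β :* β) :* (v :* v)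
                                      :+ con (ℤ.+ 2) :* a :* u :* v :* β) refl u v β a ⟩
          (a + 1#) * (u * u) + (a - 1#) * (β * β) * (v * v) + B u v * β
            ≡⟨ cong (λ t → (a + 1#) * (u * u) + (a - 1#) * t * (v * v) + B u v * β) β*β≡b ⟩
          A u v + B u v * β ∎
          where open ≡-Reasoning

        A∈K : ∀ {u v} → InSub q u → InSub q v → InSub q (A u v)
        A∈K u∈K v∈K = InSub-+ (InSub-* a+1∈K (InSub-* u∈K u∈K)) (InSub-* (InSub-* a-1∈K b∈K) (InSub-* v∈K v∈K))

        B∈K : ∀ {u v} → InSub q u → InSub q v → InSub q (B u v)
        B∈K u∈K v∈K = InSub-* (InSub-* (InSub-* InSub-2 a∈K) u∈K) v∈K

        f≡αβ⇔ : ∀ {u v} → InSub q u → InSub q v → f (u + v * β) ≡ α * β ⇔ (A u v ≡ 0# × B u v ≡ α)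
        f≡αβ⇔ {u} {v} u∈K v∈K = mk⇔
          (λ f≡αβ → let (A≡0 , B-α≡0) = coordinates-≡0 (A∈K u∈K v∈K) (InSub-+ (B∈K u∈K v∈K) (InSub-‿ α∈K)) (begin
                          A u v + (B u v - α) * β
                            ≡⟨ solve 4 (λ A B α β → A :+ (B :- α) :* β := (A :+ B :* β) :- α :* β) refl (A u v) (B u v) α β ⟩
                          (A u v + B u v * β) - α * β    ≡⟨ cong (_- α * β) (sym (f-coordinates u∈K v∈K)) ⟩
                          f (u + v * β) - α * β          ≡⟨ cong (_- α * β) f≡αβ ⟩
                          α * β - α * β                  ≡⟨ -‿inverseʳ _ ⟩
                          0#                             ∎)
                    in A≡0 , x-y≡0⇒x≡y B-α≡0)
          (λ (A≡0 , B≡α) → trans (f-coordinates u∈K v∈K) (trans (cong₂ (λ s t → s + t * β) A≡0 B≡α) (+-identityˡ _)))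
          where open ≡-Reasoning

        B≡α⇒≢0 : ∀ {u v} → B u v ≡ α → ¬ u ≡ 0# × ¬ v ≡ 0#
        B≡α⇒≢0 {u} {v} B≡α = (λ u≡0 → α≢0 (trans (sym B≡α) (trans (cong (λ t → 2# * a * t * v) u≡0)
                                               (trans (cong (_* v) (zeroʳ _)) (zeroˡ v)))))
                            , (λ v≡0 → α≢0 (trans (sym B≡α) (trans (cong (2# * a * u *_) v≡0) (zeroʳ _))))

        Γ : Carrier → Set
        Γ γ = InSub q γ × (γ * γ) * (a + 1#) ≡ - ((a - 1#) * b)

        -- A solution u + v β yields γ = u / v.
        no-Γ⇒preimageCount-αβ≡0 : (∀ γ → ¬ Γ γ) → preimageCount f (α * β) ≡ 0
        no-Γ⇒preimageCount-αβ≡0 ∄γ = length-filter-complete (λ X → f X ≟ α * β) complete unique []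
          (λ {X} → mk⇔ (⊥-elim ∘ no-solution X) (λ ()))
          where
          no-solution : ∀ X → ¬ f X ≡ α * β
          no-solution X fX≡αβ =
            let (u , v , u∈K , v∈K , X≡u+vβ) = coordinates X
                (A≡0 , B≡α) = Equivalence.to (f≡αβ⇔ u∈K v∈K) (subst (λ Y → f Y ≡ α * β) X≡u+vβ fX≡αβ)
                v≢0 = proj₂ (B≡α⇒≢0 B≡α)
            in ∄γ (u * v ⁻¹) (InSub-* u∈K (InSub-⁻¹ v∈K) , (begin
              ((u * v ⁻¹) * (u * v ⁻¹)) * (a + 1#)
                ≡⟨ solve 3 (λ u w c → ((u :* w) :* (u :* w)) :* c := (c :* (u :* u)) :* (w :* w)) refl u (v ⁻¹) (a + 1#) ⟩
              ((a + 1#) * (u * u)) * (v ⁻¹ * v ⁻¹)       ≡⟨ cong (_* (v ⁻¹ * v ⁻¹)) (-‿unique (trans (+-comm _ _) A≡0)) ⟩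
              - ((a - 1#) * b * (v * v)) * (v ⁻¹ * v ⁻¹)
                ≡⟨ solve 3 (λ c v w → :- (c :* (v :* v)) :* (w :* w) := :- c :* ((v :* w) :* (v :* w))) refl ((a - 1#) * b) v (v ⁻¹) ⟩
              - ((a - 1#) * b) * ((v * v ⁻¹) * (v * v ⁻¹)) ≡⟨ cong (λ t → - ((a - 1#) * b) * (t * t)) (x*x⁻¹≡1 v≢0) ⟩
              - ((a - 1#) * b) * (1# * 1#)               ≡⟨ trans (cong (- ((a - 1#) * b) *_) (*-identityˡ 1#)) (*-identityʳ _) ⟩
              - ((a - 1#) * b)                           ∎))
            where open ≡-Reasoning

        1-a²≢0 : ¬ 1# - a * a ≡ 0#
        1-a²≢0 1-a²≡0 with x*y≡0⇒x≡0∨y≡0 {1# - a} {1# + a} (trans [1-a][1+a]≡1-a² 1-a²≡0)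
          where
          [1-a][1+a]≡1-a² : (1# - a) * (1# + a) ≡ 1# - a * a
          [1-a][1+a]≡1-a² = solve 1 (λ a → (con (ℤ.+ 1) :- a) :* (con (ℤ.+ 1) :+ a) := con (ℤ.+ 1) :- a :* a) refl a
        ... | inj₁ 1-a≡0 = a≢1 (sym (x-y≡0⇒x≡y 1-a≡0))
        ... | inj₂ 1+a≡0 = a+1≢0 (trans (+-comm a 1#) 1+a≡0)

        1-a²∈K : InSub q (1# - a * a)
        1-a²∈K = InSub-+ InSub-1 (InSub-‿ (InSub-* a∈K a∈K))

        -- Hence Γ has a root in K exactly when (1 - a²) b is a square in K.
        [a+1]²γ²≡[1-a²]b : ∀ {γ} → (γ * γ) * (a + 1#) ≡ - ((a - 1#) * b) → ((a + 1#) * γ) * ((a + 1#) * γ) ≡ (1# - a * a) * b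
        [a+1]²γ²≡[1-a²]b {γ} γ-eq = begin
          ((a + 1#) * γ) * ((a + 1#) * γ)   ≡⟨ solve 2 (λ c γ → (c :* γ) :* (c :* γ) := c :* ((γ :* γ) :* c)) refl (a + 1#) γ ⟩
          (a + 1#) * ((γ * γ) * (a + 1#))   ≡⟨ cong ((a + 1#) *_) γ-eq ⟩
          (a + 1#) * - ((a - 1#) * b)
            ≡⟨ solve 2 (λ a b → (a :+ con (ℤ.+ 1)) :* :- ((a :- con (ℤ.+ 1)) :* b) := (con (ℤ.+ 1) :- a :* a) :* b) refl a b ⟩
          (1# - a * a) * b                  ∎
          where open ≡-Reasoning

        nonsquare⇒Γ : ¬ IsSquare (1# - a * a) → ∃ Γ
        nonsquare⇒Γ ¬□ = r * (a + 1#) ⁻¹ , InSub-* r∈K (InSub-⁻¹ a+1∈K) , (begin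
          ((r * c ⁻¹) * (r * c ⁻¹)) * c
            ≡⟨ solve 3 (λ r w c → ((r :* w) :* (r :* w)) :* c := ((r :* r) :* w) :* (c :* w)) refl r (c ⁻¹) c ⟩
          ((r * r) * c ⁻¹) * (c * c ⁻¹)   ≡⟨ cong₂ (λ s t → (s * c ⁻¹) * t) r*r≡[1-a²]b (x*x⁻¹≡1 a+1≢0) ⟩
          ((1# - a * a) * b * c ⁻¹) * 1#  ≡⟨ solve 3 (λ a b w → (((con (ℤ.+ 1) :- a :* a) :* b) :* w) :* con (ℤ.+ 1)
                                                          := :- ((a :- con (ℤ.+ 1)) :* b) :* ((a :+ con (ℤ.+ 1)) :* w)) refl a b (c ⁻¹) ⟩
          - ((a - 1#) * b) * (c * c ⁻¹)   ≡⟨ cong (- ((a - 1#) * b) *_) (x*x⁻¹≡1 a+1≢0) ⟩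
          - ((a - 1#) * b) * 1#           ≡⟨ *-identityʳ _ ⟩
          - ((a - 1#) * b)                ∎)
          where
          open ≡-Reasoning
          c = a + 1#
          □[1-a²]b = nonsquare-*-nonsquare 1-a²∈K b∈K 1-a²≢0 b≢0 ¬□ b-nonsquare
          r = proj₁ □[1-a²]b
          r∈K = proj₁ (proj₂ □[1-a²]b)
          r*r≡[1-a²]b = proj₂ (proj₂ □[1-a²]b)

        square⇒¬Γ : IsSquare (1# - a * a) → ∀ γ → ¬ Γ γ
        square⇒¬Γ (s , s∈K , s*s≡1-a²) γ (γ∈K , γ-eq) = b-nonsquare (t * s ⁻¹ , InSub-* t∈K (InSub-⁻¹ s∈K) , (begin
          (t * s ⁻¹) * (t * s ⁻¹)          ≡⟨ interchange t (s ⁻¹) t (s ⁻¹) ⟩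
          (t * t) * (s ⁻¹ * s ⁻¹)          ≡⟨ cong₂ (λ x y → x * (y ⁻¹ * y ⁻¹)) ([a+1]²γ²≡[1-a²]b γ-eq) refl ⟩
          (1# - a * a) * b * (s ⁻¹ * s ⁻¹) ≡⟨ cong (λ x → x * b * (s ⁻¹ * s ⁻¹)) (sym s*s≡1-a²) ⟩
          (s * s) * b * (s ⁻¹ * s ⁻¹)      ≡⟨ solve 3 (λ s b w → (s :* s) :* b :* (w :* w) := b :* ((s :* w) :* (s :* w))) refl s b (s ⁻¹) ⟩
          b * ((s * s ⁻¹) * (s * s ⁻¹))    ≡⟨ cong (λ x → b * (x * x)) (x*x⁻¹≡1 s≢0) ⟩
          b * (1# * 1#)                    ≡⟨ trans (cong (b *_) (*-identityˡ 1#)) (*-identityʳ b) ⟩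
          b                                ∎))
          where
          open ≡-Reasoning
          t = (a + 1#) * γ
          t∈K = InSub-* a+1∈K γ∈K
          s≢0 = x*x≡c⇒x≢0 1-a²≢0 s*s≡1-a²

        module WithΓ {γ} (γ∈K : InSub q γ) (γ-eq : (γ * γ) * (a + 1#) ≡ - ((a - 1#) * b)) where

          2a≢0 : ¬ 2# * a ≡ 0#
          2a≢0 = *-≢0 2≢0 a≢0

          γ≢0 : ¬ γ ≡ 0#
          γ≢0 γ≡0 = *-≢0 a-1≢0 b≢0 (begin
            (a - 1#) * b                ≡⟨ sym (-‿involutive _) ⟩
            - - ((a - 1#) * b)          ≡⟨ cong -_ (sym γ-eq) ⟩
            - ((γ * γ) * (a + 1#))      ≡⟨ cong (λ t → - ((t * t) * (a + 1#))) γ≡0 ⟩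
            - ((0# * 0#) * (a + 1#))    ≡⟨ cong -_ (trans (cong (_* (a + 1#)) (zeroˡ 0#)) (zeroˡ _)) ⟩
            - 0#                        ≡⟨ -0#≈0# ⟩
            0#                          ∎)
            where open ≡-Reasoning

          m g : Carrier
          m = α * (2# * a) ⁻¹
          g = γ * m

          g∈K : InSub q g
          g∈K = InSub-* γ∈K (InSub-* α∈K (InSub-⁻¹ (InSub-* InSub-2 a∈K)))

          g≢0 : ¬ g ≡ 0#
          g≢0 = *-≢0 γ≢0 (*-≢0 α≢0 (⁻¹-≢0 2a≢0))

          A≡0⇔ : ∀ {u v} → A u v ≡ 0# ⇔ u * u ≡ (γ * γ) * (v * v)
          A≡0⇔ {u} {v} = mk⇔
            (λ A≡0 → x-y≡0⇒x≡y ([ ⊥-elim ∘ a+1≢0 , id ]′ (x*y≡0⇒x≡0∨y≡0 (trans (sym A≡factor) A≡0))))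
            (λ u²≡γ²v² → trans A≡factor (trans (cong ((a + 1#) *_) (trans (cong (_- (γ * γ) * (v * v)) u²≡γ²v²) (-‿inverseʳ _))) (zeroʳ _)))
            where
            open ≡-Reasoning
            A≡factor : A u v ≡ (a + 1#) * (u * u - (γ * γ) * (v * v))
            A≡factor = begin
              (a + 1#) * (u * u) + (a - 1#) * b * (v * v)
                ≡⟨ cong (λ t → (a + 1#) * (u * u) + t * (v * v)) (trans (sym (-‿involutive _)) (cong -_ (sym γ-eq))) ⟩
              (a + 1#) * (u * u) + - ((γ * γ) * (a + 1#)) * (v * v)
                ≡⟨ solve 4 (λ c u v G → c :* (u :* u) :+ :- (G :* c) :* (v :* v) := c :* (u :* u :- G :* (v :* v)))
                           refl (a + 1#) u v (γ * γ) ⟩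
              (a + 1#) * (u * u - (γ * γ) * (v * v))                     ∎

          B≡α⇒uv≡m : ∀ {u v} → B u v ≡ α → u * v ≡ m
          B≡α⇒uv≡m {u} {v} B≡α = x*y≡z⇒y≡z*x⁻¹ 2a≢0 (trans (sym (*-assoc (2# * a) u v)) B≡α)

          -- Given u v ≡ m, the condition u² = γ² v² says u = ± γ v, i.e. u² = ± γ u v = ± g.
          square≡γ²v²⇔square≡±g : ∀ {u v} → ¬ u ≡ 0# → u * v ≡ m →
                                  u * u ≡ (γ * γ) * (v * v) ⇔ (u * u ≡ g ⊎ u * u ≡ - g)
          square≡γ²v²⇔square≡±g {u} {v} u≢0 uv≡m = mk⇔
            (λ u²≡γ²v² → Sum.map +case -case (x*x≡y*y⇒x≡±y (trans u²≡γ²v² (sym (interchange γ v γ v)))))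
            (λ u²≡±g → *-cancelˡ (*-≢0 u≢0 u≢0) (begin
              (u * u) * (u * u)
                ≡⟨ [ (λ e → cong₂ _*_ e e) , (λ e → trans (cong₂ _*_ e e) (solve 1 (λ g → :- g :* :- g := g :* g) refl g)) ]′ u²≡±g ⟩
              g * g                             ≡⟨ interchange γ m γ m ⟩
              (γ * γ) * (m * m)                 ≡⟨ cong (λ t → (γ * γ) * (t * t)) (sym uv≡m) ⟩
              (γ * γ) * ((u * v) * (u * v))
                ≡⟨ solve 3 (λ G u v → G :* ((u :* v) :* (u :* v)) := (u :* u) :* (G :* (v :* v))) refl (γ * γ) u v ⟩
              (u * u) * ((γ * γ) * (v * v))     ∎))
            where
            open ≡-Reasoning
            +case : u ≡ γ * v → u * u ≡ g
            +case u≡γv = begin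
              u * u            ≡⟨ cong (_* u) u≡γv ⟩
              (γ * v) * u      ≡⟨ solve 3 (λ γ v u → (γ :* v) :* u := γ :* (u :* v)) refl γ v u ⟩
              γ * (u * v)      ≡⟨ cong (γ *_) uv≡m ⟩
              g                ∎
            -case : u ≡ - (γ * v) → u * u ≡ - g
            -case u≡-γv = begin
              u * u            ≡⟨ cong (_* u) u≡-γv ⟩
              - (γ * v) * u    ≡⟨ solve 3 (λ γ v u → :- (γ :* v) :* u := :- (γ :* (u :* v))) refl γ v u ⟩
              - (γ * (u * v))  ≡⟨ cong (λ t → - (γ * t)) uv≡m ⟩
              - g              ∎

          V : Carrier → Carrier
          V u = α * (2# * a * u) ⁻¹

          point : Carrier → Carrier
          point u = u + V u * β

          V∈K : ∀ {u} → InSub q u → InSub q (V u)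
          V∈K u∈K = InSub-* α∈K (InSub-⁻¹ (InSub-* (InSub-* InSub-2 a∈K) u∈K))

          ±g : Carrier → Set
          ±g u = u * u ≡ g ⊎ u * u ≡ - g

          ±g⇒≢0 : ∀ {u} → ±g u → ¬ u ≡ 0#
          ±g⇒≢0 = [ x*x≡c⇒x≢0 g≢0 , x*x≡c⇒x≢0 (-‿≢0 g≢0) ]′

          -- B u v ≡ α determines v = V u, and then A u v ≡ 0 says u² = ± g.
          f≡αβ⇔point : ∀ {X} → f X ≡ α * β ⇔ ∃ λ u → (InSub q u × ±g u) × X ≡ point u
          f≡αβ⇔point {X} = mk⇔
            (λ fX≡αβ →
              let (u , v , u∈K , v∈K , X≡u+vβ) = coordinates X
                  (A≡0 , B≡α) = Equivalence.to (f≡αβ⇔ u∈K v∈K) (subst (λ Y → f Y ≡ α * β) X≡u+vβ fX≡αβ)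
                  u≢0 = proj₁ (B≡α⇒≢0 B≡α)
                  v≡Vu = x*y≡z⇒y≡z*x⁻¹ (*-≢0 2a≢0 u≢0) B≡α
              in u , (u∈K , Equivalence.to (square≡γ²v²⇔square≡±g u≢0 (B≡α⇒uv≡m B≡α)) (Equivalence.to A≡0⇔ A≡0))
                   , trans X≡u+vβ (cong (λ t → u + t * β) v≡Vu))
            (λ (u , (u∈K , ±g-u) , X≡point-u) →
              let B≡α = y≡z*x⁻¹⇒x*y≡z (*-≢0 2a≢0 (±g⇒≢0 ±g-u)) refl
                  A≡0 = Equivalence.from A≡0⇔ (Equivalence.from (square≡γ²v²⇔square≡±g (±g⇒≢0 ±g-u) (B≡α⇒uv≡m B≡α)) ±g-u)
              in subst (λ Y → f Y ≡ α * β) (sym X≡point-u) (Equivalence.from (f≡αβ⇔ u∈K (V∈K u∈K)) (A≡0 , B≡α)))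

          point-injective : ∀ {u u′} → InSub q u → InSub q u′ → point u ≡ point u′ → u ≡ u′
          point-injective {u} {u′} u∈K u′∈K point-u≡point-u′ = x-y≡0⇒x≡y (proj₁ (coordinates-≡0
            (InSub-+ u∈K (InSub-‿ u′∈K)) (InSub-+ (V∈K u∈K) (InSub-‿ (V∈K u′∈K)))
            (trans (solve 5 (λ u u′ v v′ β → (u :- u′) :+ (v :- v′) :* β := (u :+ v :* β) :- (u′ :+ v′ :* β)) refl u u′ (V u) (V u′) β)
                   (trans (cong (_- point u′) point-u≡point-u′) (-‿inverseʳ _)))))

          preimageCount-αβ : (d₊ : Dec (IsSquare g)) (d₋ : Dec (IsSquare (- g))) →
                             preimageCount f (α * β) ≡ length (map point (subRoots d₊ ++ subRoots d₋))
          preimageCount-αβ d₊ d₋ = length-filter-complete (λ X → f X ≟ α * β) complete unique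
            (map⁺-injectiveOn point (λ u∈ u′∈ → point-injective (proj₁ (roots⇒ u∈)) (proj₁ (roots⇒ u′∈))) roots!)
            (λ {X} → mk⇔
              (λ fX≡αβ → let (u , (u∈K , ±g-u) , X≡point-u) = Equivalence.to f≡αβ⇔point fX≡αβ
                         in subst (_∈ map point roots) (sym X≡point-u) (∈-map⁺ point (⇒roots u∈K ±g-u)))
              (λ X∈ → let (u , u∈ , X≡point-u) = ∈-map⁻ point X∈
                      in Equivalence.from f≡αβ⇔point (u , roots⇒ u∈ , X≡point-u)))
            where
            roots = subRoots d₊ ++ subRoots d₋
            roots⇒ : ∀ {u} → u ∈ roots → InSub q u × ±g u
            roots⇒ u∈ with Equivalence.to ++-∈⇔ u∈
            ... | inj₁ u∈₊ = let (u∈K , u²≡g) = Equivalence.to (∈-subRoots⇔ d₊) u∈₊ in u∈K , inj₁ u²≡g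
            ... | inj₂ u∈₋ = let (u∈K , u²≡-g) = Equivalence.to (∈-subRoots⇔ d₋) u∈₋ in u∈K , inj₂ u²≡-g
            ⇒roots : ∀ {u} → InSub q u → ±g u → u ∈ roots
            ⇒roots u∈K (inj₁ u²≡g)  = ∈-++⁺ˡ (Equivalence.from (∈-subRoots⇔ d₊) (u∈K , u²≡g))
            ⇒roots u∈K (inj₂ u²≡-g) = ∈-++⁺ʳ (subRoots d₊) (Equivalence.from (∈-subRoots⇔ d₋) (u∈K , u²≡-g))
            roots! : Unique roots
            roots! = Unique.++⁺ (subRoots! g≢0 d₊) (subRoots! (-‿≢0 g≢0) d₋) (λ (u∈₊ , u∈₋) →
              x≢-x g≢0 (trans (sym (proj₂ (Equivalence.to (∈-subRoots⇔ d₊) u∈₊))) (proj₂ (Equivalence.to (∈-subRoots⇔ d₋) u∈₋))))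

          -1-nonsquare⇒preimageCount-αβ≡2 : ¬ IsSquare (- 1#) → preimageCount f (α * β) ≡ 2
          -1-nonsquare⇒preimageCount-αβ≡2 ¬□-1 = count (isSquare? g) (isSquare? (- g))
            where
            count : (d₊ : Dec (IsSquare g)) (d₋ : Dec (IsSquare (- g))) → preimageCount f (α * β) ≡ 2
            count (yes □g) (yes □-g) = ⊥-elim (¬□-1 (subst IsSquare (begin
              (- g * g) * (g ⁻¹ * g ⁻¹)     ≡⟨ solve 2 (λ g w → (:- g :* g) :* (w :* w) := :- ((g :* w) :* (g :* w))) refl g (g ⁻¹) ⟩
              - ((g * g ⁻¹) * (g * g ⁻¹))   ≡⟨ cong (λ t → - (t * t)) (x*x⁻¹≡1 g≢0) ⟩
              - (1# * 1#)                   ≡⟨ cong -_ (*-identityˡ 1#) ⟩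
              - 1#                          ∎) (square-*-square (square-* □-g □g) (InSub-⁻¹ g∈K))))
              where open ≡-Reasoning
            count (yes □g) (no ¬□-g) = preimageCount-αβ (yes □g) (no ¬□-g)
            count (no ¬□g) (yes □-g) = preimageCount-αβ (no ¬□g) (yes □-g)
            count (no ¬□g) (no ¬□-g) = ⊥-elim (¬□-g (subst IsSquare (-1*x≈-x g)
              (nonsquare-*-nonsquare (InSub-‿ InSub-1) g∈K (-‿≢0 1≢0) g≢0 ¬□-1 ¬□g)))

          -1-square⇒preimageCount-αβ : IsSquare (- 1#) →
            (IsSquare g → preimageCount f (α * β) ≡ 4) × (¬ IsSquare g → preimageCount f (α * β) ≡ 0)
          -1-square⇒preimageCount-αβ □-1 =
              (λ □g → preimageCount-αβ (yes □g) (yes (negate □g)))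
            , (λ ¬□g → preimageCount-αβ (no ¬□g) (no (¬□g ∘ subst IsSquare (-‿involutive g) ∘ negate)))
            where
            negate : ∀ {x} → IsSquare x → IsSquare (- x)
            negate {x} □x = subst IsSquare (-1*x≈-x x) (square-* □-1 □x)

          2γαa≢0 : ¬ 2# * γ * α * a ≡ 0#
          2γαa≢0 = *-≢0 (*-≢0 (*-≢0 2≢0 γ≢0) α≢0) a≢0

          -- 2 γ α a = (γ α) (2 a) and g = (γ α) / (2 a) differ by the square factor (2 a)².
          square-2γαa⇔square-g : IsSquare (2# * γ * α * a) ⇔ IsSquare g
          square-2γαa⇔square-g = mk⇔
            (subst IsSquare (sym g≡) ∘ square-*⇒square-*⁻¹ 2a∈K 2a≢0 ∘ subst IsSquare T≡)
            (subst IsSquare (sym T≡) ∘ square-*⁻¹⇒square-* 2a∈K 2a≢0 ∘ subst IsSquare g≡)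
            where
            2a∈K = InSub-* InSub-2 a∈K
            T≡ : 2# * γ * α * a ≡ (γ * α) * (2# * a)
            T≡ = solve 3 (λ γ α a → con (ℤ.+ 2) :* γ :* α :* a := (γ :* α) :* (con (ℤ.+ 2) :* a)) refl γ α a
            g≡ : g ≡ (γ * α) * (2# * a) ⁻¹
            g≡ = sym (*-assoc γ α _)

        part₂ : q % 4 ≡ 3 →
                (χ₂ q (1# - a * a) ≡ 1ℤ → preimageCount f (α * β) ≡ 0)
              × (χ₂ q (1# - a * a) ≡ -1ℤ → preimageCount f (α * β) ≡ 2)
        part₂ q%4≡3 =
            (λ χ≡1 → no-Γ⇒preimageCount-αβ≡0 (square⇒¬Γ (χ₂≡1⇒square χ≡1)))
          , (λ χ≡-1 → let (γ , γ∈K , γ-eq) = nonsquare⇒Γ (χ₂≡-1⇒nonsquare χ≡-1)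
                      in WithΓ.-1-nonsquare⇒preimageCount-αβ≡2 γ∈K γ-eq (-1-nonsquare q%4≡3))

        part₃ : q % 4 ≡ 1 →
                (χ₂ q (1# - a * a) ≡ -1ℤ →
                  (γ : Carrier) → InSub q γ → (γ * γ) * (a + 1#) ≡ - ((a - 1#) * b) →
                    (χ₂ q (2# * γ * α * a) ≡ 1ℤ → preimageCount f (α * β) ≡ 4)
                    × (¬ (χ₂ q (2# * γ * α * a) ≡ 1ℤ) → preimageCount f (α * β) ≡ 0))
              × (¬ (χ₂ q (1# - a * a) ≡ -1ℤ) → preimageCount f (α * β) ≡ 0)
        part₃ q%4≡1 =
            (λ _ γ γ∈K γ-eq → let open WithΓ γ∈K γ-eq
                                  (count≡4 , count≡0) = -1-square⇒preimageCount-αβ (-1-square q%4≡1)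
                              in (count≡4 ∘ Equivalence.to square-2γαa⇔square-g ∘ χ₂≡1⇒square)
                               , (λ χ≢1 → count≡0 (χ≢1 ∘ square⇒χ₂≡1 2γαa≢0 ∘ Equivalence.from square-2γαa⇔square-g)))
          , (λ χ≢-1 → no-Γ⇒preimageCount-αβ≡0 (square⇒¬Γ (decidable-stable (isSquare? (1# - a * a))
                                                  (χ≢-1 ∘ nonsquare⇒χ₂≡-1 1-a²≢0))))


theorem4p1 : (p k q : ℕ) → Prime p → ¬ (p ≡ 2) → k ≥ 1 → q ≡ p ℕ.^ k →
    (L : FiniteField) → FiniteField.size L ≡ q ℕ.* q →
    let open FiniteField L renaming (_^_ to _^ᴸ_) in
    (a : Carrier) → InSub q a → ¬ (a ≡ 0#) → ¬ (a ≡ 1#) → ¬ (a ≡ - 1#) →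
    let f = λ (X : Carrier) → (X ^ᴸ suc q) + (a * (X * X)) in
    (b β : Carrier) → InSub q b → χ₂ q b ≡ -1ℤ → β * β ≡ b →
    (α : Carrier) → InSub q α → ¬ (α ≡ 0#) →
    ((χ₂ q (α * (a - 1#)) ≡ 1ℤ → χ₂ q (α * (a + 1#)) ≡ -1ℤ → preimageCount f α ≡ 0)
     × (χ₂ q (α * (a - 1#)) ≡ -1ℤ → χ₂ q (α * (a + 1#)) ≡ 1ℤ → preimageCount f α ≡ 4)
     × (¬ (χ₂ q (α * (a - 1#)) ≡ 1ℤ × χ₂ q (α * (a + 1#)) ≡ -1ℤ) →
        ¬ (χ₂ q (α * (a - 1#)) ≡ -1ℤ × χ₂ q (α * (a + 1#)) ≡ 1ℤ) →
        preimageCount f α ≡ 2))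
    × (q % 4 ≡ 3 →
        (χ₂ q (1# - a * a) ≡ 1ℤ → preimageCount f (α * β) ≡ 0)
        × (χ₂ q (1# - a * a) ≡ -1ℤ → preimageCount f (α * β) ≡ 2))
    × (q % 4 ≡ 1 →
        (χ₂ q (1# - a * a) ≡ -1ℤ →
          (γ : Carrier) → InSub q γ → (γ * γ) * (a + 1#) ≡ - ((a - 1#) * b) →
            (χ₂ q (2# * γ * α * a) ≡ 1ℤ → preimageCount f (α * β) ≡ 4)
            × (¬ (χ₂ q (2# * γ * α * a) ≡ 1ℤ) → preimageCount f (α * β) ≡ 0))
        × (¬ (χ₂ q (1# - a * a) ≡ -1ℤ) → preimageCount f (α * β) ≡ 0))
theorem4p1 p k q p-prime p≢2 _ q≡p^k L size≡q*q a a∈K a≢0 a≢1 a≢-1 b β b∈K χb≡-1 β*β≡b α α∈K α≢0 =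
  part₁ , part₂ , part₃
  where
  open FiniteFieldProperties.Subfield.QuadraticExtension.Preimages
         L {k = k} p-prime p≢2 q≡p^k size≡q*q b∈K χb≡-1 β*β≡b a∈K a≢0 a≢1 a≢-1 α∈K α≢0
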